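{- Let $\Delta$ be a positive integer and let $\mathcal{A}$ be Algorithm $\mathcal{A}(-1,\Delta+1)$ (defined in the context), run on a uniformly random ordering of a set $\mathcal{I}=\{opt_1,\dots,opt_\alpha\}$ of $\alpha\ge3$ pairwise disjoint closed unit-length intervals contained in $[0,\Delta)$, ordered from left to right. Fix $i\in\{1,\dots,\alpha\}$, write $opt_i=[f,f+1]$, and let $l=\lfloor f\rfloor$ and $r=\lfloor f+2\rfloor$. Then, conditioned on the event that $opt_i$ arrives before all other intervals of $\mathcal{I}$: (1) $\mathbb{E}[|R_l\cup OUT(\mathcal{A}^R_l)|\mid opt_i\text{ arrives first}]\ge1+out(\alpha-i)$, and (2) $\mathbb{E}[|L_r\cup OUT(\mathcal{A}^L_r)|\mid opt_i\text{ arrives first}]\ge1+out(i-1)$, where $R_l,\mathcal{A}^R_l,L_r,\mathcal{A}^L_r$ refer to the variables and recursive instances of the top-level run of $\mathcal{A}$ at the end of the stream.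
   Context: For closed intervals $I=[a_I,b_I]$, $J=[a_J,b_J]$: $I$ is further left than $J$ if $a_I<a_J$; further right if $b_I>b_J$; independent if $I\cap J=\varnothing$. Algorithm $\mathcal{A}(a,b)$, for integers $a<b$, processes a stream of closed unit-length intervals each contained in $[a,b)$. At initialisation, for each integer $i\in\{a+1,\dots,b-1\}$ it sets $L_i\gets\emptyset$, $R_i\gets\emptyset$ and creates recursive instances $\mathcal{T}^L_i$, $\mathcal{A}^L_i$ of $\mathcal{A}(a,i)$ and $\mathcal{T}^R_i$, $\mathcal{A}^R_i$ of $\mathcal{A}(i,b)$. When an interval $I$ arrives, for each such $i$: if $I\subseteq[i,b)$: feed $I$ into $\mathcal{T}^R_i$; if $R_i=\emptyset$ or $I$ is further left than $R_i$, set $R_i\gets I$; then if $R_i\ne\emptyset$, $I$ is independent of $R_i$ and further right than $R_i$, feed $I$ into $\mathcal{A}^R_i$. If $I\subseteq[a,i)$: feed $I$ into $\mathcal{T}^L_i$; if $L_i=\emptyset$ or $I$ is further right than $L_i$, set $L_i\gets I$; then if $L_i\ne\emptyset$, $I$ is independent of $L_i$ and further left than $L_i$, feed $I$ into $\mathcal{A}^L_i$. The output $OUT(\cdot)$ of an instance is a largest set among $OUT(\mathcal{T}^L_i)\cup R_i\cup OUT(\mathcal{A}^R_i)$ and $OUT(\mathcal{A}^L_i)\cup L_i\cup OUT(\mathcal{T}^R_i)$ over all its split points $i$ (empty variables contribute nothing; empty output if no split points). For an integer $x\ge0$, $out(x)=\min_{\mathcal{J}}\mathbb{E}_{S\sim\Pi(\mathcal{J})}|OUT(\mathcal{A}(S))|$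 over finite sets $\mathcal{J}$ of closed unit intervals in $[0,\Delta)$ whose maximum independent set has size $x$ ($\Pi(\mathcal{J})$: uniformly random ordering), and $out(x)=0$ for $x<0$.
   Formalization: The intervals $opt_1,\dots,opt_\alpha$ have rational endpoints, and the sets $\mathcal{J}$ defining $out(x)$ are likewise taken over unit intervals with rational endpoints. -}

module Defs where

open import Data.Bool using (Bool; true; false; _∧_; _∨_; if_then_else_)
open import Data.Nat as ℕ using (ℕ; zero; suc; _∸_)
open import Data.Integer as ℤ using (ℤ; +_; -[1+_]; ∣_∣)
import Data.Integer.Properties as ℤP
open import Data.Rational using (ℚ; _/_; _+_; _-_; _≤_; _<_; 0ℚ; 1ℚ; floor)
open import Data.Rational.Properties using (_≤?_; _<?_)
open import Data.List using (List; []; _∷_; _++_; map; filterᵇ; length; upTo; concatMap; foldr)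
open import Data.Nat.ListAction using (sum)
open import Data.Nat.Properties as ℕP using ()
open import Data.List.Relation.Unary.All using (All)
open import Data.List.Relation.Unary.Unique.Propositional using (Unique)
open import Data.Maybe using (Maybe; just; nothing)
open import Data.Product using (_×_; _,_; proj₁; proj₂; ∃)
open import Relation.Nullary.Decidable using (⌊_⌋; does)
open import Relation.Binary.PropositionalEquality using (_≡_)

-- Intervals.  A closed unit-length interval [f, f+1] is represented by
-- its left endpoint f : ℚ.

Interval : Set
Interval = ℚ

toℚ : ℤ → ℚ
toℚ z = z / 1

_<ᵇ_ : ℚ → ℚ → Bool
p <ᵇ q = does (p <? q)

_≤ᵇ_ : ℚ → ℚ → Bool
p ≤ᵇ q = does (p ≤? q)

containedᵇ : ℚ → ℚ → Interval → Bool
containedᵇ a b f = (a ≤ᵇ f) ∧ ((f + 1ℚ) <ᵇ b)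

furtherLeftᵇ : Interval → Interval → Bool
furtherLeftᵇ I J = I <ᵇ J

furtherRightᵇ : Interval → Interval → Bool
furtherRightᵇ I J = (J + 1ℚ) <ᵇ (I + 1ℚ)

independentᵇ : Interval → Interval → Bool
independentᵇ I J = ((I + 1ℚ) <ᵇ J) ∨ ((J + 1ℚ) <ᵇ I)

maybeToList : Maybe Interval → List Interval
maybeToList nothing  = []
maybeToList (just x) = x ∷ []

updR : Interval → Maybe Interval → Maybe Interval
updR I nothing  = just I
updR I (just r) = if furtherLeftᵇ I r then just I else just r

updL : Interval → Maybe Interval → Maybe Interval
updL I nothing  = just I
updL I (just l) = if furtherRightᵇ I l then just I else just l

-- Right-hand bookkeeping of split point i in an instance A(a,b):
-- processes the stream (in arrival order), starting from the current R_i,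
-- returning the final R_i and the stream fed into A^R_i.

scanR : ℚ → ℚ → List Interval → Maybe Interval → Maybe Interval × List Interval
scanR i b [] R = R , []
scanR i b (I ∷ s) R with containedᵇ i b I
... | false = scanR i b s R
... | true = step R' (scanR i b s R')
  where
  R' : Maybe Interval
  R' = updR I R
  feed : Maybe Interval → Bool
  feed nothing  = false
  feed (just r) = independentᵇ I r ∧ furtherRightᵇ I r
  step : Maybe Interval → Maybe Interval × List Interval → Maybe Interval × List Interval
  step r (fin , fed) = fin , (if feed r then I ∷ fed else fed)

-- Left-hand bookkeeping of split point i in A(a,b): final L_i and the
-- stream fed into A^L_i.
scanL : ℚ → ℚ → List Interval → Maybe Interval → Maybe Interval × List Interval
scanL a i [] L = L , []
scanL a i (I ∷ s) L with containedᵇ a i I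
... | false = scanL a i s L
... | true = step L' (scanL a i s L')
  where
  L' : Maybe Interval
  L' = updL I L
  feed : Maybe Interval → Bool
  feed nothing  = false
  feed (just l) = independentᵇ I l ∧ furtherLeftᵇ I l
  step : Maybe Interval → Maybe Interval × List Interval → Maybe Interval × List Interval
  step l (fin , fed) = fin , (if feed l then I ∷ fed else fed)

splitPoints : ℤ → ℤ → List ℤ
splitPoints a b with does (a ℤP.<? b)
... | true  = map (λ k → a ℤ.+ + suc k) (upTo (∣ b ℤ.- a ∣ ∸ 1))
... | false = []

-- a largest list among the given ones (the first one of maximal length)
largest : List (List Interval) → List Interval
largest = foldr (λ x best → if does (length best ℕP.≤? length x) then x else best) []

-- OUT of an instance A(a,b) that has received the stream s (arrival order).
-- The first argument is recursion fuel; fuel ≥ b - a suffices, since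
-- every recursive instance is strictly narrower (see OUT below).
runA : ℕ → ℤ → ℤ → List Interval → List Interval
runA zero    a b s = []
runA (suc m) a b s = largest (concatMap cands (splitPoints a b))
  where
  cands : ℤ → List (List Interval)
  cands i = (runA m a i (filterᵇ (containedᵇ (toℚ a) (toℚ i)) s)
               ++ maybeToList (proj₁ R) ++ runA m i b (proj₂ R))
          ∷ (runA m a i (proj₂ L) ++ maybeToList (proj₁ L)
               ++ runA m i b (filterᵇ (containedᵇ (toℚ i) (toℚ b)) s))
          ∷ []
    where
    R = scanR (toℚ i) (toℚ b) s nothing
    L = scanL (toℚ a) (toℚ i) s nothing

OUT : ℤ → ℤ → List Interval → List Interval
OUT a b s = runA ∣ b ℤ.- a ∣ a b s

top-a : ℤ
top-a = -[1+ 0 ]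

top-b : ℕ → ℤ
top-b Δ = + suc Δ

sizeRside : ℕ → ℤ → List Interval → ℕ
sizeRside Δ i s = length (maybeToList (proj₁ X) ++ OUT i (top-b Δ) (proj₂ X))
  where X = scanR (toℚ i) (toℚ (top-b Δ)) s nothing

sizeLside : ℕ → ℤ → List Interval → ℕ
sizeLside Δ i s = length (maybeToList (proj₁ X) ++ OUT top-a i (proj₂ X))
  where X = scanL (toℚ top-a) (toℚ i) s nothing

-- Uniformly random orderings: all permutations of a list of distinct
-- elements, each exactly once.

insertions : Interval → List Interval → List (List Interval)
insertions x []       = (x ∷ []) ∷ []
insertions x (y ∷ ys) = (x ∷ y ∷ ys) ∷ map (y ∷_) (insertions x ys)

orderings : List Interval → List (List Interval)
orderings []       = [] ∷ []
orderings (x ∷ xs) = concatMap (insertions x) (orderings xs)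

average : List ℕ → ℚ
average []         = 0ℚ
average (x ∷ xs)   = (+ sum (x ∷ xs)) / length (x ∷ xs)

𝔼ord : List Interval → (List Interval → ℕ) → ℚ
𝔼ord J g = average (map g (orderings J))

InRange : ℕ → Interval → Set
InRange Δ f = (0ℚ ≤ f) × (f + 1ℚ < toℚ (+ Δ))

-- a finite set of closed unit intervals in [0,Δ), as a duplicate-free list
ValidSet : ℕ → List Interval → Set
ValidSet Δ J = Unique J × All (InRange Δ) J

sublists : List Interval → List (List Interval)
sublists []       = [] ∷ []
sublists (x ∷ xs) = map (x ∷_) (sublists xs) ++ sublists xs

allᵇ : (Interval → Bool) → List Interval → Bool
allᵇ p []       = true
allᵇ p (x ∷ xs) = p x ∧ allᵇ p xs

pairwiseIndepᵇ : List Interval → Bool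
pairwiseIndepᵇ []       = true
pairwiseIndepᵇ (x ∷ xs) = allᵇ (independentᵇ x) xs ∧ pairwiseIndepᵇ xs

maxℕ : List ℕ → ℕ
maxℕ = foldr ℕ._⊔_ 0

misSize : List Interval → ℕ
misSize J = maxℕ (map length (filterᵇ pairwiseIndepᵇ (sublists J)))

expOut : ℕ → List Interval → ℚ
expOut Δ J = 𝔼ord J (λ S → length (OUT top-a (top-b Δ) S))

-- "e ≥ 1 + out(x)", where out(x) = min over valid J with MIS size x of
-- expOut Δ J.  Stated via the infimum: for every ε > 0 there is such a
-- J with expOut Δ J ≤ e - 1 + ε.
AtLeastOnePlusOut : ℕ → ℕ → ℚ → Set
AtLeastOnePlusOut Δ x e =
  (ε : ℚ) → 0ℚ < ε →
  ∃ λ J → ValidSet Δ J × misSize J ≡ x × expOut Δ J ≤ (e - 1ℚ) + ε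

{-# OPTIONS --safe #-}
module Submission where

-- Write opt_i = [o, o+1] and l = ⌊o⌋.  If opt_i arrives first it becomes R_l and is never replaced:
-- later optimal intervals to its left are not contained in [l, Δ+1), and those to its right are
-- independent of it and further right, so they are fed into A^R_l, in arrival order, and nothing else
-- is.  An instance whose intervals all lie in [c+1, b) has the same output size as every A(a, b) with
-- a ≤ c, so |R_l ∪ OUT(A^R_l)| = 1 + |OUT(A(-1, Δ+1))| on the right-hand optimal intervals.  Filtering
-- a uniformly random ordering leaves a uniformly random ordering of what is kept, hence the conditional
-- expectation equals 1 + E|OUT(A(-1, Δ+1))| for the α - i optimal intervals right of opt_i, a set whose
-- maximum independent set has size α - i; this set attains the infimum defining out(α - i).  The left
-- side is the mirror image, with r = ⌊o + 2⌋.

open import Defs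

open import Data.Bool using (Bool; true; false; T; _∧_; if_then_else_)
open import Data.Bool.Properties using (∧-zeroʳ; ∨-zeroʳ; ∧-conicalˡ; ∧-conicalʳ)
open import Data.Empty using (⊥-elim)
open import Data.Fin using (Fin; toℕ; zero; suc)
import Data.Fin.Properties as Finₚ
open import Data.Integer as ℤ using (ℤ; +_; 1ℤ; ∣_∣)
import Data.Integer.DivMod as ℤ
import Data.Integer.Properties as ℤₚ
open import Data.Integer.Tactic.RingSolver using (solve-∀)
open import Data.List using (List; []; _∷_; _++_; map; filterᵇ; length; concat; concatMap; upTo; lookup; removeAt; take; drop)
import Data.List.Properties as LP
open import Data.List.Membership.Propositional using (_∈_)
open import Data.List.Membership.Propositional.Properties
  using (∈-map⁺; ∈-map⁻; ∈-upTo⁺; ∈-upTo⁻; ∈-concat⁺′; ∈-filter⁺; ∈-++⁺ˡ; ∈-lookup)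
open import Data.List.Relation.Binary.Permutation.Propositional
  using (_↭_; prep; swap; ↭-reflexive) renaming (refl to ↭-refl; trans to ↭-trans)
open import Data.List.Relation.Binary.Permutation.Propositional.Properties using (++-comm)
open import Data.List.Relation.Unary.All as All using (All; []; _∷_)
import Data.List.Relation.Unary.All.Properties as Allₚ
open import Data.List.Relation.Unary.AllPairs as AllPairs using (AllPairs; []; _∷_)
import Data.List.Relation.Unary.AllPairs.Properties as AllPairsₚ
open import Data.List.Relation.Unary.Any using (here; there)
open import Data.List.Relation.Unary.Unique.Propositional using (Unique)
open import Data.Maybe using (Maybe; just; nothing)
import Data.Maybe.Relation.Unary.All as Maybe
open import Data.Nat as ℕ using (ℕ; zero; suc; _∸_)
import Data.Nat.Coprimality as Coprime
open import Data.Nat.ListAction using (sum)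
open import Data.Nat.ListAction.Properties using (sum-++)
import Data.Nat.Properties as ℕₚ
open import Data.Nat.Tactic.RingSolver using () renaming (solve-∀ to ℕ-solve-∀)
open import Data.Product using (_×_; _,_; proj₁; proj₂)
open import Data.Rational as ℚ using (ℚ; mkℚ; _+_; _<_; _≤_; 0ℚ; 1ℚ; floor; *≤*; *<*; toℚᵘ)
import Data.Rational.Properties as ℚₚ
open import Algebra.Properties.AbelianGroup ℚₚ.+-0-abelianGroup using (xyx⁻¹≈y)
import Data.Rational.Unnormalised as ℚᵘ
import Data.Rational.Unnormalised.Properties as ℚᵘₚ
open import Data.Sum using (_⊎_; inj₁; inj₂)
open import Function using (_∘_)
open import Relation.Binary using (tri<; tri≈; tri>)
open import Relation.Binary.PropositionalEquality
open import Relation.Nullary using (¬_; Dec; yes; no)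
open import Relation.Nullary.Decidable using (does; dec-true; dec-false; T?)

toℚ≡mkℚ : ∀ z → toℚ z ≡ mkℚ z 0 (Coprime.sym (Coprime.1-coprimeTo ℤ.∣ z ∣))
toℚ≡mkℚ z = ℚₚ.↥p/↧p≡p _

toℚ-mono-≤ : ∀ {z w} → z ℤ.≤ w → toℚ z ≤ toℚ w
toℚ-mono-≤ {z} {w} z≤w rewrite toℚ≡mkℚ z | toℚ≡mkℚ w =
  *≤* (subst₂ ℤ._≤_ (sym (ℤₚ.*-identityʳ z)) (sym (ℤₚ.*-identityʳ w)) z≤w)

toℚ-mono-< : ∀ {z w} → z ℤ.< w → toℚ z < toℚ w
toℚ-mono-< {z} {w} z<w rewrite toℚ≡mkℚ z | toℚ≡mkℚ w =
  *<* (subst₂ ℤ._<_ (sym (ℤₚ.*-identityʳ z)) (sym (ℤₚ.*-identityʳ w)) z<w)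

toℚ-cancel-< : ∀ {z w} → toℚ z < toℚ w → z ℤ.< w
toℚ-cancel-< {z} {w} z<w with ℤₚ.<-cmp z w
... | tri< z<w _ _    = z<w
... | tri≈ _ refl _   = ⊥-elim (ℚₚ.<-irrefl refl z<w)
... | tri> _ _ w<z    = ⊥-elim (ℚₚ.<-asym z<w (toℚ-mono-< w<z))

toℚ-suc : ∀ z → toℚ (ℤ.suc z) ≡ toℚ z + 1ℚ
toℚ-suc z = ℚₚ.toℚᵘ-injective (ℚᵘₚ.≃-trans lhs (ℚᵘₚ.≃-sym (ℚₚ.toℚᵘ-homo-+ (toℚ z) 1ℚ)))
  where
  lhs : toℚᵘ (toℚ (ℤ.suc z)) ℚᵘ.≃ (toℚᵘ (toℚ z) ℚᵘ.+ toℚᵘ 1ℚ)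
  lhs rewrite toℚ≡mkℚ (ℤ.suc z) | toℚ≡mkℚ z = ℚᵘ.*≡* (cross z)
    where
    cross : ∀ z → (1ℤ ℤ.+ z) ℤ.* 1ℤ ≡ (z ℤ.* 1ℤ ℤ.+ 1ℤ ℤ.* 1ℤ) ℤ.* 1ℤ
    cross = solve-∀

toℚ-pred : ∀ z → toℚ z ≡ toℚ (ℤ.pred z) + 1ℚ
toℚ-pred z = trans (cong toℚ (sym (ℤₚ.suc-pred z))) (toℚ-suc (ℤ.pred z))

toℚ⌊p⌋≤p : ∀ p → toℚ (floor p) ≤ p
toℚ⌊p⌋≤p p@(mkℚ n d _) rewrite toℚ≡mkℚ (floor p) =
  *≤* (ℤₚ.≤-trans (ℤₚ.i≤j+i (n ℤ./ D ℤ.* D) (+ (n ℤ.% D)))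
        (ℤₚ.≤-reflexive (trans (sym (ℤ.a≡a%n+[a/n]*n n D)) (sym (ℤₚ.*-identityʳ n)))))
  where D = + suc d

p<toℚ⌊p⌋+1 : ∀ p → p < toℚ (ℤ.suc (floor p))
p<toℚ⌊p⌋+1 p@(mkℚ n d _) rewrite toℚ≡mkℚ (ℤ.suc (floor p)) =
  *<* (subst₂ ℤ._<_ (trans (sym (ℤ.a≡a%n+[a/n]*n n D)) (sym (ℤₚ.*-identityʳ n))) (quotient+1 f D)
        (ℤₚ.+-monoˡ-< (f ℤ.* D) (ℤ.+<+ (ℤ.n%d<d n D))))
  where
  D = + suc d
  f = n ℤ./ D
  quotient+1 : ∀ q e → e ℤ.+ q ℤ.* e ≡ (1ℤ ℤ.+ q) ℤ.* e
  quotient+1 = solve-∀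

p<p+1 : ∀ p → p < p + 1ℚ
p<p+1 p = subst (_< p + 1ℚ) (ℚₚ.+-identityʳ p) (ℚₚ.+-monoʳ-< p (*<* (ℤ.+<+ (ℕ.s≤s ℕ.z≤n))))

+1-mono-< : ∀ {p q} → p < q → p + 1ℚ < q + 1ℚ
+1-mono-< = ℚₚ.+-monoˡ-< 1ℚ

+1-cancel-< : ∀ {p q} → p + 1ℚ < q + 1ℚ → p < q
+1-cancel-< {p} {q} h = subst₂ _<_ (minus-one p) (minus-one q) (ℚₚ.+-monoˡ-< (ℚ.- 1ℚ) h)
  where
  minus-one : ∀ x → x + 1ℚ + ℚ.- 1ℚ ≡ x
  minus-one x = trans (ℚₚ.+-assoc x 1ℚ (ℚ.- 1ℚ)) (trans (cong (_+_ x) (ℚₚ.+-inverseʳ 1ℚ)) (ℚₚ.+-identityʳ x))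

dec-true⁻¹ : ∀ {A : Set} (a? : Dec A) → does a? ≡ true → A
dec-true⁻¹ (yes a) _ = a

<⇒<ᵇ : ∀ {p q} → p < q → (p <ᵇ q) ≡ true
<⇒<ᵇ {p} {q} = dec-true (p ℚₚ.<? q)

≮⇒<ᵇ≡false : ∀ {p q} → ¬ p < q → (p <ᵇ q) ≡ false
≮⇒<ᵇ≡false {p} {q} = dec-false (p ℚₚ.<? q)

<ᵇ⇒< : ∀ p q → (p <ᵇ q) ≡ true → p < q
<ᵇ⇒< p q = dec-true⁻¹ (p ℚₚ.<? q)

record Within (x y : ℚ) (I : Interval) : Set where
  constructor within
  field
    lower : x ≤ I
    upper : I + 1ℚ < y

module _ {x y I : ℚ} where

  containedᵇ-true : Within x y I → containedᵇ x y I ≡ true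
  containedᵇ-true (within x≤I I+1<y) rewrite dec-true (x ℚₚ.≤? I) x≤I = <⇒<ᵇ I+1<y

  containedᵇ-true⁻¹ : containedᵇ x y I ≡ true → Within x y I
  containedᵇ-true⁻¹ h =
    within (dec-true⁻¹ (x ℚₚ.≤? I) (∧-conicalˡ _ _ h)) (dec-true⁻¹ (I + 1ℚ ℚₚ.<? y) (∧-conicalʳ _ _ h))

  containedᵇ-false : ¬ Within x y I → containedᵇ x y I ≡ false
  containedᵇ-false outside with x ℚₚ.≤? I | I + 1ℚ ℚₚ.<? y
  ... | yes x≤I | yes I+1<y = ⊥-elim (outside (within x≤I I+1<y))
  ... | yes _   | no I+1≮y  rewrite dec-false (I + 1ℚ ℚₚ.<? y) I+1≮y = ∧-zeroʳ (x ≤ᵇ I)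
  ... | no x≰I  | _         rewrite dec-false (x ℚₚ.≤? I) x≰I = refl

containedᵇ-congˡ : ∀ {x x′} y {I} → x ≤ I → x′ ≤ I → containedᵇ x y I ≡ containedᵇ x′ y I
containedᵇ-congˡ {x} {x′} y {I} x≤I x′≤I
  rewrite dec-true (x ℚₚ.≤? I) x≤I | dec-true (x′ ℚₚ.≤? I) x′≤I = refl

containedᵇ-congʳ : ∀ x I {y y′} → I + 1ℚ < y → I + 1ℚ < y′ → containedᵇ x y I ≡ containedᵇ x y′ I
containedᵇ-congʳ x I {y} {y′} I+1<y I+1<y′
  rewrite dec-true (I + 1ℚ ℚₚ.<? y) I+1<y | dec-true (I + 1ℚ ℚₚ.<? y′) I+1<y′ = refl

module _ {A : Set} (p : A → Bool) where

  filterᵇ-accept : ∀ {x} xs → p x ≡ true → filterᵇ p (x ∷ xs) ≡ x ∷ filterᵇ p xs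
  filterᵇ-accept xs px rewrite px = refl

  filterᵇ-reject : ∀ {x} xs → p x ≡ false → filterᵇ p (x ∷ xs) ≡ filterᵇ p xs
  filterᵇ-reject xs px rewrite px = refl

  filterᵇ-all : ∀ xs → All (λ x → p x ≡ true) xs → filterᵇ p xs ≡ xs
  filterᵇ-all []       []         = refl
  filterᵇ-all (x ∷ xs) (px ∷ pxs) rewrite px = cong (x ∷_) (filterᵇ-all xs pxs)

  filterᵇ-none : ∀ xs → All (λ x → p x ≡ false) xs → filterᵇ p xs ≡ []
  filterᵇ-none []       []         = refl
  filterᵇ-none (x ∷ xs) (px ∷ pxs) rewrite px = filterᵇ-none xs pxs

  filterᵇ-All : ∀ {P : A → Set} xs → All (λ x → p x ≡ true → P x) xs → All P (filterᵇ p xs)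
  filterᵇ-All []       []       = []
  filterᵇ-All (x ∷ xs) (h ∷ hs) with p x
  ... | true  = h refl ∷ filterᵇ-All xs hs
  ... | false = filterᵇ-All xs hs

filterᵇ-cong : ∀ {A : Set} {p p′ : A → Bool} xs → All (λ x → p x ≡ p′ x) xs → filterᵇ p xs ≡ filterᵇ p′ xs
filterᵇ-cong {p = p} {p′} []       []       = refl
filterᵇ-cong {p = p} {p′} (x ∷ xs) (e ∷ es) with p x | p′ x | e
... | true  | .true  | refl = cong (x ∷_) (filterᵇ-cong xs es)
... | false | .false | refl = filterᵇ-cong xs es

-- The bookkeeping of a split point

consIf : Bool → Interval → List Interval → List Interval
consIf c I s = if c then I ∷ s else s

feedsR : Interval → Maybe Interval → Bool
feedsR I nothing  = false
feedsR I (just r) = independentᵇ I r ∧ furtherRightᵇ I r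

feedsL : Interval → Maybe Interval → Bool
feedsL I nothing  = false
feedsL I (just l) = independentᵇ I l ∧ furtherLeftᵇ I l

-- Defs.scanR hides its step in a where block; the proofs unfold this copy, whose test is abstracted.
scanRWith : (Interval → Bool) → List Interval → Maybe Interval → Maybe Interval × List Interval
scanRWith p []      R = R , []
scanRWith p (I ∷ s) R with p I
... | false = scanRWith p s R
... | true  = proj₁ (scanRWith p s (updR I R)) , consIf (feedsR I (updR I R)) I (proj₂ (scanRWith p s (updR I R)))

scanLWith : (Interval → Bool) → List Interval → Maybe Interval → Maybe Interval × List Interval
scanLWith p []      L = L , []
scanLWith p (I ∷ s) L with p I
... | false = scanLWith p s L
... | true  = proj₁ (scanLWith p s (updL I L)) , consIf (feedsL I (updL I L)) I (proj₂ (scanLWith p s (updL I L)))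

scanR≡scanRWith : ∀ i b s R → scanR i b s R ≡ scanRWith (containedᵇ i b) s R
scanR≡scanRWith i b []      R = refl
scanR≡scanRWith i b (I ∷ s) R with containedᵇ i b I
... | false = scanR≡scanRWith i b s R
... | true rewrite scanR≡scanRWith i b s (updR I R) with updR I R
...   | nothing = refl
...   | just _  = refl

scanL≡scanLWith : ∀ a i s L → scanL a i s L ≡ scanLWith (containedᵇ a i) s L
scanL≡scanLWith a i []      L = refl
scanL≡scanLWith a i (I ∷ s) L with containedᵇ a i I
... | false = scanL≡scanLWith a i s L
... | true rewrite scanL≡scanLWith a i s (updL I L) with updL I L
...   | nothing = refl
...   | just _  = refl

feedsR⇒beyond : ∀ I r → feedsR I (just r) ≡ true → r + 1ℚ < I
feedsR⇒beyond I r h with (I + 1ℚ) <ᵇ r in e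
... | true  = ⊥-elim (ℚₚ.<-asym (ℚₚ.<-trans (p<p+1 I) (<ᵇ⇒< (I + 1ℚ) r e))
                                (+1-cancel-< (<ᵇ⇒< (r + 1ℚ) (I + 1ℚ) (∧-conicalʳ _ _ h))))
... | false = <ᵇ⇒< (r + 1ℚ) I (∧-conicalˡ _ _ h)

feedsL⇒beyond : ∀ I l → feedsL I (just l) ≡ true → I + 1ℚ < l
feedsL⇒beyond I l h with (I + 1ℚ) <ᵇ l in e
... | true  = <ᵇ⇒< (I + 1ℚ) l e
... | false = ⊥-elim (ℚₚ.<-asym (ℚₚ.<-trans (p<p+1 l) (<ᵇ⇒< (l + 1ℚ) I (∧-conicalˡ _ _ h)))
                                (<ᵇ⇒< I l (∧-conicalʳ _ _ h)))

consIf-All : ∀ {P : Interval → Set} c I s → (c ≡ true → P I) → All P s → All P (consIf c I s)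
consIf-All true  I s pI ps = pI refl ∷ ps
consIf-All false I s pI ps = ps

updR-All : ∀ {P : Interval → Set} {I} R → P I → Maybe.All P R → Maybe.All P (updR I R)
updR-All          nothing  pI _          = Maybe.just pI
updR-All {I = I} (just r) pI (Maybe.just pr) with furtherLeftᵇ I r
... | true  = Maybe.just pI
... | false = Maybe.just pr

updL-All : ∀ {P : Interval → Set} {I} L → P I → Maybe.All P L → Maybe.All P (updL I L)
updL-All          nothing  pI _          = Maybe.just pI
updL-All {I = I} (just l) pI (Maybe.just pl) with furtherRightᵇ I l
... | true  = Maybe.just pI
... | false = Maybe.just pl

module _ {p p′ : Interval → Bool} where

  scanRWith-cong : ∀ s R → All (λ I → p I ≡ p′ I) s → scanRWith p s R ≡ scanRWith p′ s R
  scanRWith-cong []      R []       = refl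
  scanRWith-cong (I ∷ s) R (e ∷ es) with p I | p′ I | e
  ... | true  | .true  | refl rewrite scanRWith-cong s (updR I R) es = refl
  ... | false | .false | refl = scanRWith-cong s R es

  scanLWith-cong : ∀ s L → All (λ I → p I ≡ p′ I) s → scanLWith p s L ≡ scanLWith p′ s L
  scanLWith-cong []      L []       = refl
  scanLWith-cong (I ∷ s) L (e ∷ es) with p I | p′ I | e
  ... | true  | .true  | refl rewrite scanLWith-cong s (updL I L) es = refl
  ... | false | .false | refl = scanLWith-cong s L es

module _ {p : Interval → Bool} where

  scanRWith-reject : ∀ s R → All (λ I → p I ≡ false) s → scanRWith p s R ≡ (R , [])
  scanRWith-reject []      R []       = refl
  scanRWith-reject (I ∷ s) R (e ∷ es) rewrite e = scanRWith-reject s R es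

  scanLWith-reject : ∀ s L → All (λ I → p I ≡ false) s → scanLWith p s L ≡ (L , [])
  scanLWith-reject []      L []       = refl
  scanLWith-reject (I ∷ s) L (e ∷ es) rewrite e = scanLWith-reject s L es

  scanRWith-fed : ∀ {P : Interval → Set} s R → All (λ I → p I ≡ true → P I) s →
                  All P (proj₂ (scanRWith p s R))
  scanRWith-fed []      R []       = []
  scanRWith-fed (I ∷ s) R (h ∷ hs) with p I
  ... | false = scanRWith-fed s R hs
  ... | true  = consIf-All (feedsR I (updR I R)) I _ (λ _ → h refl) (scanRWith-fed s (updR I R) hs)

  scanLWith-fed : ∀ {P : Interval → Set} s L → All (λ I → p I ≡ true → P I) s →
                  All P (proj₂ (scanLWith p s L))
  scanLWith-fed []      L []       = []
  scanLWith-fed (I ∷ s) L (h ∷ hs) with p I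
  ... | false = scanLWith-fed s L hs
  ... | true  = consIf-All (feedsL I (updL I L)) I _ (λ _ → h refl) (scanLWith-fed s (updL I L) hs)

  scanRWith-fed-≥ : ∀ {x} s R → Maybe.All (x ≤_) R → All (λ I → p I ≡ true → x ≤ I) s →
                    All (λ I → x + 1ℚ < I) (proj₂ (scanRWith p s R))
  scanRWith-fed-≥ []      R _  []       = []
  scanRWith-fed-≥ {x} (I ∷ s) R xR (h ∷ hs) with p I
  ... | false = scanRWith-fed-≥ s R xR hs
  ... | true  = consIf-All (feedsR I R′) I _ (fed-≥ R′ xR′) (scanRWith-fed-≥ s R′ xR′ hs)
    where
    R′  = updR I R
    xR′ = updR-All R (h refl) xR
    fed-≥ : ∀ R → Maybe.All (x ≤_) R → feedsR I R ≡ true → x + 1ℚ < I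
    fed-≥ (just r) (Maybe.just x≤r) fed = ℚₚ.≤-<-trans (ℚₚ.+-monoˡ-≤ 1ℚ x≤r) (feedsR⇒beyond I r fed)

  scanLWith-fed-≤ : ∀ {y} s L → Maybe.All (λ l → l + 1ℚ < y) L → All (λ I → p I ≡ true → I + 1ℚ < y) s →
                    All (λ I → I + 1ℚ + 1ℚ < y) (proj₂ (scanLWith p s L))
  scanLWith-fed-≤ []      L _  []       = []
  scanLWith-fed-≤ {y} (I ∷ s) L yL (h ∷ hs) with p I
  ... | false = scanLWith-fed-≤ s L yL hs
  ... | true  = consIf-All (feedsL I L′) I _ (fed-≤ L′ yL′) (scanLWith-fed-≤ s L′ yL′ hs)
    where
    L′  = updL I L
    yL′ = updL-All L (h refl) yL
    fed-≤ : ∀ L → Maybe.All (λ l → l + 1ℚ < y) L → feedsL I L ≡ true → I + 1ℚ + 1ℚ < y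
    fed-≤ (just l) (Maybe.just l+1<y) fed = ℚₚ.<-trans (+1-mono-< (feedsL⇒beyond I l fed)) l+1<y

independentᵇ-self : ∀ o → independentᵇ o o ≡ false
independentᵇ-self o rewrite ≮⇒<ᵇ≡false (ℚₚ.<-asym (p<p+1 o)) = refl

module _ {o I : ℚ} where

  updR-keeps : o < I → updR I (just o) ≡ just o
  updR-keeps o<I rewrite ≮⇒<ᵇ≡false (ℚₚ.<-asym o<I) = refl

  updL-keeps : I < o → updL I (just o) ≡ just o
  updL-keeps I<o rewrite ≮⇒<ᵇ≡false (ℚₚ.<-asym (+1-mono-< I<o)) = refl

  feedsR-beyond : o + 1ℚ < I → feedsR I (just o) ≡ true
  feedsR-beyond o+1<I rewrite <⇒<ᵇ o+1<I | ∨-zeroʳ ((I + 1ℚ) <ᵇ o)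
    = <⇒<ᵇ (+1-mono-< (ℚₚ.<-trans (p<p+1 o) o+1<I))

  feedsL-beyond : I + 1ℚ < o → feedsL I (just o) ≡ true
  feedsL-beyond I+1<o rewrite <⇒<ᵇ I+1<o = <⇒<ᵇ (ℚₚ.<-trans (p<p+1 I) I+1<o)

module _ {p : Interval → Bool} {o : ℚ} where

  scanRWith-keeps : ∀ π → All (λ I → (p I ≡ false × ¬ o < I) ⊎ (p I ≡ true × o + 1ℚ < I)) π →
                    scanRWith p π (just o) ≡ (just o , filterᵇ (o <ᵇ_) π)
  scanRWith-keeps []      []                         = refl
  scanRWith-keeps (I ∷ π) (inj₁ (rejected , o≮I) ∷ hs) with p I | rejected
  ... | false | refl = trans (scanRWith-keeps π hs)
                         (cong (just o ,_) (sym (filterᵇ-reject (o <ᵇ_) {I} π (≮⇒<ᵇ≡false o≮I))))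
  scanRWith-keeps (I ∷ π) (inj₂ (accepted , o+1<I) ∷ hs) with p I | accepted
  ... | true | refl = begin
    step (updR I (just o))
      ≡⟨ cong step (updR-keeps o<I) ⟩
    step (just o)
      ≡⟨ cong₂ (λ X c → proj₁ X , consIf c I (proj₂ X)) (scanRWith-keeps π hs) (feedsR-beyond {o} {I} o+1<I) ⟩
    (just o , I ∷ filterᵇ (o <ᵇ_) π)
      ≡⟨ cong (just o ,_) (sym (filterᵇ-accept (o <ᵇ_) {I} π (<⇒<ᵇ o<I))) ⟩
    (just o , filterᵇ (o <ᵇ_) (I ∷ π)) ∎
    where
    open ≡-Reasoning
    o<I = ℚₚ.<-trans (p<p+1 o) o+1<I
    step : Maybe Interval → Maybe Interval × List Interval
    step R = proj₁ (scanRWith p π R) , consIf (feedsR I R) I (proj₂ (scanRWith p π R))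

  scanLWith-keeps : ∀ π → All (λ I → (p I ≡ false × ¬ I < o) ⊎ (p I ≡ true × I + 1ℚ < o)) π →
                    scanLWith p π (just o) ≡ (just o , filterᵇ (_<ᵇ o) π)
  scanLWith-keeps []      []                         = refl
  scanLWith-keeps (I ∷ π) (inj₁ (rejected , I≮o) ∷ hs) with p I | rejected
  ... | false | refl = trans (scanLWith-keeps π hs)
                         (cong (just o ,_) (sym (filterᵇ-reject (_<ᵇ o) {I} π (≮⇒<ᵇ≡false {I} {o} I≮o))))
  scanLWith-keeps (I ∷ π) (inj₂ (accepted , I+1<o) ∷ hs) with p I | accepted
  ... | true | refl = begin
    step (updL I (just o))
      ≡⟨ cong step (updL-keeps I<o) ⟩
    step (just o)
      ≡⟨ cong₂ (λ X c → proj₁ X , consIf c I (proj₂ X)) (scanLWith-keeps π hs) (feedsL-beyond {o} {I} I+1<o) ⟩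
    (just o , I ∷ filterᵇ (_<ᵇ o) π)
      ≡⟨ cong (just o ,_) (sym (filterᵇ-accept (_<ᵇ o) {I} π (<⇒<ᵇ I<o))) ⟩
    (just o , filterᵇ (_<ᵇ o) (I ∷ π)) ∎
    where
    open ≡-Reasoning
    I<o = ℚₚ.<-trans (p<p+1 I) I+1<o
    step : Maybe Interval → Maybe Interval × List Interval
    step L = proj₁ (scanLWith p π L) , consIf (feedsL I L) I (proj₂ (scanLWith p π L))

  scanRWith-first : p o ≡ true → ∀ π → All (λ I → (p I ≡ false × ¬ o < I) ⊎ (p I ≡ true × o + 1ℚ < I)) π →
                    scanRWith p (o ∷ π) nothing ≡ (just o , filterᵇ (o <ᵇ_) π)
  scanRWith-first accepted π hs with p o | accepted
  ... | true | refl rewrite independentᵇ-self o = scanRWith-keeps π hs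

  scanLWith-first : p o ≡ true → ∀ π → All (λ I → (p I ≡ false × ¬ I < o) ⊎ (p I ≡ true × I + 1ℚ < o)) π →
                    scanLWith p (o ∷ π) nothing ≡ (just o , filterᵇ (_<ᵇ o) π)
  scanLWith-first accepted π hs with p o | accepted
  ... | true | refl rewrite independentᵇ-self o = scanLWith-keeps π hs

module _ {i b : ℚ} where

  scanR-cong : ∀ {i′ b′} s → All (λ I → containedᵇ i b I ≡ containedᵇ i′ b′ I) s →
               scanR i b s nothing ≡ scanR i′ b′ s nothing
  scanR-cong {i′} {b′} s same = trans (scanR≡scanRWith i b s nothing)
    (trans (scanRWith-cong s nothing same) (sym (scanR≡scanRWith i′ b′ s nothing)))

  scanR-reject : ∀ s → All (λ I → containedᵇ i b I ≡ false) s → scanR i b s nothing ≡ (nothing , [])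
  scanR-reject s rejected = trans (scanR≡scanRWith i b s nothing) (scanRWith-reject s nothing rejected)

  scanR-fed : ∀ {P : Interval → Set} s → All (λ I → containedᵇ i b I ≡ true → P I) s →
              All P (proj₂ (scanR i b s nothing))
  scanR-fed {P} s h = subst (λ X → All P (proj₂ X)) (sym (scanR≡scanRWith i b s nothing)) (scanRWith-fed s nothing h)

  scanR-fed-≥ : ∀ {x} s → All (λ I → containedᵇ i b I ≡ true → x ≤ I) s →
                All (λ I → x + 1ℚ < I) (proj₂ (scanR i b s nothing))
  scanR-fed-≥ {x} s h = subst (λ X → All (λ I → x + 1ℚ < I) (proj₂ X)) (sym (scanR≡scanRWith i b s nothing))
    (scanRWith-fed-≥ s nothing Maybe.nothing h)

module _ {a i : ℚ} where

  scanL-cong : ∀ {a′ i′} s → All (λ I → containedᵇ a i I ≡ containedᵇ a′ i′ I) s →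
               scanL a i s nothing ≡ scanL a′ i′ s nothing
  scanL-cong {a′} {i′} s same = trans (scanL≡scanLWith a i s nothing)
    (trans (scanLWith-cong s nothing same) (sym (scanL≡scanLWith a′ i′ s nothing)))

  scanL-reject : ∀ s → All (λ I → containedᵇ a i I ≡ false) s → scanL a i s nothing ≡ (nothing , [])
  scanL-reject s rejected = trans (scanL≡scanLWith a i s nothing) (scanLWith-reject s nothing rejected)

  scanL-fed : ∀ {P : Interval → Set} s → All (λ I → containedᵇ a i I ≡ true → P I) s →
              All P (proj₂ (scanL a i s nothing))
  scanL-fed {P} s h = subst (λ X → All P (proj₂ X)) (sym (scanL≡scanLWith a i s nothing)) (scanLWith-fed s nothing h)

  scanL-fed-≤ : ∀ {y} s → All (λ I → containedᵇ a i I ≡ true → I + 1ℚ < y) s →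
                All (λ I → I + 1ℚ + 1ℚ < y) (proj₂ (scanL a i s nothing))
  scanL-fed-≤ {y} s h = subst (λ X → All (λ I → I + 1ℚ + 1ℚ < y) (proj₂ X)) (sym (scanL≡scanLWith a i s nothing))
    (scanLWith-fed-≤ s nothing Maybe.nothing h)

-- Output sizes of the recursive algorithm

a+[b-a]≡b : ∀ a b → a ℤ.+ (b ℤ.- a) ≡ b
a+[b-a]≡b = solve-∀

a+∣b-a∣≡b : ∀ {a b} → a ℤ.≤ b → a ℤ.+ + ∣ b ℤ.- a ∣ ≡ b
a+∣b-a∣≡b {a} {b} a≤b = trans (cong (ℤ._+_ a) (ℤₚ.0≤i⇒+∣i∣≡i (ℤₚ.i≤j⇒0≤j-i a≤b))) (a+[b-a]≡b a b)

ℤ+-cancelˡ-< : ∀ a {x y} → a ℤ.+ x ℤ.< a ℤ.+ y → x ℤ.< y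
ℤ+-cancelˡ-< a {x} {y} h = subst₂ ℤ._<_ (-a+[a+z]≡z a x) (-a+[a+z]≡z a y) (ℤₚ.+-monoʳ-< (ℤ.- a) h)
  where
  -a+[a+z]≡z : ∀ a z → ℤ.- a ℤ.+ (a ℤ.+ z) ≡ z
  -a+[a+z]≡z = solve-∀

splitPoints-≤ : ∀ {a b} → b ℤ.≤ a → splitPoints a b ≡ []
splitPoints-≤ {a} {b} b≤a with a ℤₚ.<? b
... | yes a<b = ⊥-elim (ℤₚ.<⇒≱ a<b b≤a)
... | no  _   = refl

∈-splitPoints⁻ : ∀ {a b i} → i ∈ splitPoints a b → a ℤ.< i × i ℤ.< b
∈-splitPoints⁻ {a} {b} {i} i∈ with a ℤₚ.<? b
... | yes a<b with ∈-map⁻ (λ k → a ℤ.+ + suc k) i∈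
...   | k , k∈ , refl =
  subst (ℤ._< a ℤ.+ + suc k) (ℤₚ.+-identityʳ a) (ℤₚ.+-monoʳ-< a (ℤ.+<+ ℕ.z<s)) ,
  subst (a ℤ.+ + suc k ℤ.<_) (a+∣b-a∣≡b (ℤₚ.<⇒≤ a<b))
    (ℤₚ.+-monoʳ-< a (ℤ.+<+ (ℕₚ.pred-cancel-< {suc k} (∈-upTo⁻ k∈))))

∈-splitPoints⁺ : ∀ {a b i} → a ℤ.< i → i ℤ.< b → i ∈ splitPoints a b
∈-splitPoints⁺ {a} {b} {i} a<i i<b with a ℤₚ.<? b
... | no  a≮b = ⊥-elim (a≮b (ℤₚ.<-trans a<i i<b))
... | yes a<b = subst (_∈ _) (a+∣b-a∣≡b (ℤₚ.<⇒≤ a<i)) (offset-∈ ∣ i ℤ.- a ∣ lower upper)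
  where
  a+∣i-a∣≡i = a+∣b-a∣≡b (ℤₚ.<⇒≤ a<i)
  lower : 0 ℕ.< ∣ i ℤ.- a ∣
  lower = ℤₚ.drop‿+<+ (ℤ+-cancelˡ-< a (subst₂ ℤ._<_ (sym (ℤₚ.+-identityʳ a)) (sym a+∣i-a∣≡i) a<i))
  upper : ∣ i ℤ.- a ∣ ℕ.< ∣ b ℤ.- a ∣
  upper = ℤₚ.drop‿+<+ (ℤ+-cancelˡ-< a (subst₂ ℤ._<_ (sym a+∣i-a∣≡i) (sym (a+∣b-a∣≡b (ℤₚ.<⇒≤ a<b))) i<b))
  offset-∈ : ∀ j → 0 ℕ.< j → j ℕ.< ∣ b ℤ.- a ∣ →
             a ℤ.+ + j ∈ map (λ k → a ℤ.+ + suc k) (upTo (∣ b ℤ.- a ∣ ∸ 1))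
  offset-∈ (suc k) _ j<n = ∈-map⁺ (λ k → a ℤ.+ + suc k) (∈-upTo⁺ (ℕₚ.pred-mono-< j<n))

-- Recursion depth m suffices for A(a, b).  It is a record so that m, a and b are inferable from a proof.
record Fuel (m : ℕ) (a b : ℤ) : Set where
  constructor fuel
  field enough : b ℤ.≤ a ℤ.+ + m

Fuel-∣b-a∣ : ∀ a b → Fuel ∣ b ℤ.- a ∣ a b
Fuel-∣b-a∣ a b with a ℤₚ.≤? b
... | yes a≤b = fuel (ℤₚ.≤-reflexive (sym (a+∣b-a∣≡b a≤b)))
... | no  a≰b = fuel (ℤₚ.≤-trans (ℤₚ.<⇒≤ (ℤₚ.≰⇒> a≰b)) (ℤₚ.i≤i+j a (+ _)))

Fuel-zero : ∀ {a b} → Fuel 0 a b → b ℤ.≤ a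
Fuel-zero {a} (fuel b≤a) = subst (_ ℤ.≤_) (ℤₚ.+-identityʳ a) b≤a

Fuel-mono : ∀ {m m′ a b} → m ℕ.≤ m′ → Fuel m a b → Fuel m′ a b
Fuel-mono {a = a} m≤m′ (fuel b≤a+m) = fuel (ℤₚ.≤-trans b≤a+m (ℤₚ.+-monoʳ-≤ a (ℤ.+≤+ m≤m′)))

Fuel-narrowˡ : ∀ {m a c b} → a ℤ.≤ c → Fuel m a b → Fuel m c b
Fuel-narrowˡ {m} a≤c (fuel b≤a+m) = fuel (ℤₚ.≤-trans b≤a+m (ℤₚ.+-monoˡ-≤ (+ m) a≤c))

Fuel-narrowʳ : ∀ {m a c b} → c ℤ.≤ b → Fuel m a b → Fuel m a c
Fuel-narrowʳ c≤b (fuel b≤a+m) = fuel (ℤₚ.≤-trans c≤b b≤a+m)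

Fuel-splitˡ : ∀ {m a b i} → i ℤ.< b → Fuel (suc m) a b → Fuel m a i
Fuel-splitˡ {m} {a} {i = i} i<b (fuel b≤a+1+m) = fuel (subst (i ℤ.≤_) (ℤₚ.pred-suc (a ℤ.+ + m))
  (ℤₚ.i<j⇒i≤pred[j] (ℤₚ.<-≤-trans i<b (subst (_ ℤ.≤_) (a+[1+m]≡1+[a+m] a (+ m)) b≤a+1+m))))
  where
  a+[1+m]≡1+[a+m] : ∀ a m → a ℤ.+ (1ℤ ℤ.+ m) ≡ 1ℤ ℤ.+ (a ℤ.+ m)
  a+[1+m]≡1+[a+m] = solve-∀

Fuel-splitʳ : ∀ {m a b i} → a ℤ.< i → Fuel (suc m) a b → Fuel m i b
Fuel-splitʳ {m} {a} a<i (fuel b≤a+1+m) = fuel (ℤₚ.≤-trans b≤a+1+m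
  (subst (ℤ._≤ _) ([1+a]+m≡a+[1+m] a (+ m)) (ℤₚ.+-monoˡ-≤ (+ m) (ℤₚ.i<j⇒suc[i]≤j a<i))))
  where
  [1+a]+m≡a+[1+m] : ∀ a m → (1ℤ ℤ.+ a) ℤ.+ m ≡ a ℤ.+ (1ℤ ℤ.+ m)
  [1+a]+m≡a+[1+m] = solve-∀

maxℕ-lub : ∀ {n} xs → All (ℕ._≤ n) xs → maxℕ xs ℕ.≤ n
maxℕ-lub []       []         = ℕ.z≤n
maxℕ-lub (x ∷ xs) (x≤n ∷ xs≤n) = ℕₚ.⊔-lub x≤n (maxℕ-lub xs xs≤n)

maxℕ-ub : ∀ {x} xs → x ∈ xs → x ℕ.≤ maxℕ xs
maxℕ-ub (y ∷ ys) (here refl) = ℕₚ.m≤m⊔n y _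
maxℕ-ub (y ∷ ys) (there x∈) = ℕₚ.≤-trans (maxℕ-ub ys x∈) (ℕₚ.m≤n⊔m y _)

length-largest : ∀ Ls → length (largest Ls) ≡ maxℕ (map length Ls)
length-largest []       = refl
length-largest (L ∷ Ls) with length (largest Ls) ℕ.≤ᵇ length L in e | length-largest Ls
... | true  | ih = sym (ℕₚ.m≥n⇒m⊔n≡m (subst (ℕ._≤ length L) ih (ℕₚ.≤ᵇ⇒≤ _ _ (subst T (sym e) _))))
... | false | ih = trans ih (sym (ℕₚ.m≤n⇒m⊔n≡n (subst (length L ℕ.≤_) ih
                     (ℕₚ.≰⇒≥ (λ L≤ → subst T e (ℕₚ.≤⇒≤ᵇ L≤))))))

concatMap-cong-∈ : ∀ {A B : Set} {f g : A → List B} xs → (∀ {x} → x ∈ xs → f x ≡ g x) →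
                   concatMap f xs ≡ concatMap g xs
concatMap-cong-∈ xs f≡g = cong concat (LP.map-cong-local (All.tabulate f≡g))

outSize : ℕ → ℤ → ℤ → List Interval → ℕ
outSize m a b s = length (runA m a b s)

rightSize : ℕ → ℤ → ℤ → List Interval → ℤ → ℕ
rightSize m a b s i =
  outSize m a i (filterᵇ (containedᵇ (toℚ a) (toℚ i)) s) ℕ.+ (length (maybeToList (proj₁ R)) ℕ.+ outSize m i b (proj₂ R))
  where R = scanR (toℚ i) (toℚ b) s nothing

leftSize : ℕ → ℤ → ℤ → List Interval → ℤ → ℕ
leftSize m a b s i =
  outSize m a i (proj₂ L) ℕ.+ (length (maybeToList (proj₁ L)) ℕ.+ outSize m i b (filterᵇ (containedᵇ (toℚ i) (toℚ b)) s))
  where L = scanL (toℚ a) (toℚ i) s nothing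

candidateSizes : ℕ → ℤ → ℤ → List Interval → ℤ → List ℕ
candidateSizes m a b s i = rightSize m a b s i ∷ leftSize m a b s i ∷ []

outSize-suc : ∀ m a b s → outSize (suc m) a b s ≡ maxℕ (concatMap (candidateSizes m a b s) (splitPoints a b))
outSize-suc m a b s = trans (length-largest (concatMap candidates (splitPoints a b))) (cong maxℕ (sizes (splitPoints a b)))
  where
  length-++₃ : ∀ (x y z : List Interval) → length (x ++ y ++ z) ≡ length x ℕ.+ (length y ℕ.+ length z)
  length-++₃ x y z = trans (LP.length-++ x) (cong (length x ℕ.+_) (LP.length-++ y))
  candidates : ℤ → List (List Interval)
  candidates i = (runA m a i (filterᵇ (containedᵇ (toℚ a) (toℚ i)) s) ++ maybeToList (proj₁ R) ++ runA m i b (proj₂ R))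
               ∷ (runA m a i (proj₂ L) ++ maybeToList (proj₁ L) ++ runA m i b (filterᵇ (containedᵇ (toℚ i) (toℚ b)) s))
               ∷ []
    where
    R = scanR (toℚ i) (toℚ b) s nothing
    L = scanL (toℚ a) (toℚ i) s nothing
  sizes : ∀ is → map length (concatMap candidates is) ≡ concatMap (candidateSizes m a b s) is
  sizes []       = refl
  sizes (i ∷ is) = cong₂ _∷_ (length-++₃ (runA m a i _) (maybeToList _) (runA m i b _))
                   (cong₂ _∷_ (length-++₃ (runA m a i _) (maybeToList _) (runA m i b _)) (sizes is))

module _ (m : ℕ) (a b : ℤ) (s : List Interval) where

  outSize-suc-≤ : ∀ {n} → (∀ i → a ℤ.< i → i ℤ.< b → rightSize m a b s i ℕ.≤ n × leftSize m a b s i ℕ.≤ n) →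
                  outSize (suc m) a b s ℕ.≤ n
  outSize-suc-≤ bound = subst (ℕ._≤ _) (sym (outSize-suc m a b s)) (maxℕ-lub _
    (Allₚ.concat⁺ (Allₚ.map⁺ (All.tabulate λ {i} i∈ →
      let a<i , i<b = ∈-splitPoints⁻ i∈ ; r≤n , l≤n = bound i a<i i<b in r≤n ∷ l≤n ∷ []))))

  candidateSizes-≤ : ∀ {i n} → a ℤ.< i → i ℤ.< b → n ∈ candidateSizes m a b s i → n ℕ.≤ outSize (suc m) a b s
  candidateSizes-≤ a<i i<b n∈ = subst (_ ℕ.≤_) (sym (outSize-suc m a b s))
    (maxℕ-ub _ (∈-concat⁺′ n∈ (∈-map⁺ (candidateSizes m a b s) (∈-splitPoints⁺ a<i i<b))))

  rightSize-≤ : ∀ {i} → a ℤ.< i → i ℤ.< b → rightSize m a b s i ℕ.≤ outSize (suc m) a b s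
  rightSize-≤ a<i i<b = candidateSizes-≤ a<i i<b (here refl)

  leftSize-≤ : ∀ {i} → a ℤ.< i → i ℤ.< b → leftSize m a b s i ℕ.≤ outSize (suc m) a b s
  leftSize-≤ a<i i<b = candidateSizes-≤ a<i i<b (there (here refl))

outSize-[] : ∀ m a b → outSize m a b [] ≡ 0
outSize-[] zero    a b = refl
outSize-[] (suc m) a b = ℕₚ.n≤0⇒n≡0 (outSize-suc-≤ m a b [] λ i _ _ →
  ℕₚ.≤-reflexive (cong₂ ℕ._+_ (outSize-[] m a i) (outSize-[] m i b)) ,
  ℕₚ.≤-reflexive (cong₂ ℕ._+_ (outSize-[] m a i) (outSize-[] m i b)))

candidateSizes-cong : ∀ m m′ a b s i → (∀ t → outSize m a i t ≡ outSize m′ a i t) →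
                      (∀ t → outSize m i b t ≡ outSize m′ i b t) → candidateSizes m a b s i ≡ candidateSizes m′ a b s i
candidateSizes-cong m m′ a b s i eqˡ eqʳ =
  cong₂ (λ r l → r ∷ l ∷ [])
    (cong₂ ℕ._+_ (eqˡ _) (cong (_ ℕ.+_) (eqʳ _)))
    (cong₂ ℕ._+_ (eqˡ _) (cong (_ ℕ.+_) (eqʳ _)))

outSize-fuel : ∀ m {a b} s → Fuel m a b → outSize m a b s ≡ outSize (suc m) a b s
outSize-fuel zero {a} {b} s enough = sym (trans (outSize-suc 0 a b s)
  (cong (λ is → maxℕ (concatMap (candidateSizes 0 a b s) is)) (splitPoints-≤ (Fuel-zero enough))))
outSize-fuel (suc m) {a} {b} s enough = begin
  outSize (suc m) a b s                                               ≡⟨ outSize-suc m a b s ⟩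
  maxℕ (concatMap (candidateSizes m a b s) (splitPoints a b))       ≡⟨ cong maxℕ (concatMap-cong-∈ _ same) ⟩
  maxℕ (concatMap (candidateSizes (suc m) a b s) (splitPoints a b)) ≡⟨ outSize-suc (suc m) a b s ⟨
  outSize (suc (suc m)) a b s                                         ∎
  where
  open ≡-Reasoning
  same : ∀ {i} → i ∈ splitPoints a b → candidateSizes m a b s i ≡ candidateSizes (suc m) a b s i
  same {i} i∈ = let a<i , i<b = ∈-splitPoints⁻ i∈ in candidateSizes-cong m (suc m) a b s i
    (λ t → outSize-fuel m t (Fuel-splitˡ i<b enough)) (λ t → outSize-fuel m t (Fuel-splitʳ a<i enough))

outSize-fuel-+ : ∀ d m {a b} s → Fuel m a b → outSize m a b s ≡ outSize (d ℕ.+ m) a b s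
outSize-fuel-+ zero    m s enough = refl
outSize-fuel-+ (suc d) m s enough =
  trans (outSize-fuel-+ d m s enough) (outSize-fuel (d ℕ.+ m) s (Fuel-mono (ℕₚ.m≤n+m m d) enough))

outSize-fuel-irrelevant : ∀ {m m′ a b} s → Fuel m a b → Fuel m′ a b → outSize m a b s ≡ outSize m′ a b s
outSize-fuel-irrelevant {m} {m′} s enough enough′ with ℕₚ.≤-total m m′
... | inj₁ m≤m′ = trans (outSize-fuel-+ (m′ ∸ m) m s enough) (cong (λ k → outSize k _ _ s) (ℕₚ.m∸n+n≡m m≤m′))
... | inj₂ m′≤m = sym (trans (outSize-fuel-+ (m ∸ m′) m′ s enough′)
                              (cong (λ k → outSize k _ _ s) (ℕₚ.m∸n+n≡m m′≤m)))

-- Shrinking an instance towards its intervals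

-- Split points i ≤ c of A(a, b) see nothing on their left, so their candidates are bounded by
-- candidates of A(c, b) at the split point c+1; split points i > c give equal candidates in both.
ShrinkˡAt : ℕ → Set
ShrinkˡAt m = ∀ {a c b} X → Fuel m a b → a ℤ.≤ c → All (Within (toℚ (ℤ.suc c)) (toℚ b)) X →
              outSize m a b X ≡ outSize m c b X

module ShrinkˡStep {m : ℕ} (shrinkˡ : ShrinkˡAt m) {a c b : ℤ} {X : List Interval} (enough : Fuel (suc m) a b)
                   (a≤c : a ℤ.≤ c) (inside : All (Within (toℚ (ℤ.suc c)) (toℚ b)) X) where

  c<c⁺ : c ℤ.< ℤ.suc c
  c<c⁺ = ℤₚ.suc[i]≤j⇒i<j ℤₚ.≤-refl

  ≤-inside : ∀ {x} → x ℤ.≤ ℤ.suc c → All (λ I → toℚ x ≤ I) X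
  ≤-inside x≤c⁺ = All.map (λ (within c⁺≤I _) → ℚₚ.≤-trans (toℚ-mono-≤ x≤c⁺) c⁺≤I) inside

  beyond : ∀ x {i} → i ℤ.≤ c → All (λ I → ¬ Within x (toℚ i) I) X
  beyond x i≤c = All.map (λ (within c⁺≤I _) (within _ I+1<i) → ℚₚ.<-irrefl refl
    (ℚₚ.<-≤-trans (ℚₚ.<-≤-trans (toℚ-mono-< (ℤₚ.≤-<-trans i≤c c<c⁺)) c⁺≤I)
                  (ℚₚ.<⇒≤ (ℚₚ.<-trans (p<p+1 _) I+1<i)))) inside

  tests-agree : ∀ i → All (λ I → containedᵇ (toℚ a) (toℚ i) I ≡ containedᵇ (toℚ c) (toℚ i) I) X
  tests-agree i = All.zipWith (λ (a≤I , c≤I) → containedᵇ-congˡ (toℚ i) a≤I c≤I)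
    (≤-inside (ℤₚ.≤-trans a≤c (ℤₚ.<⇒≤ c<c⁺)) , ≤-inside (ℤₚ.<⇒≤ c<c⁺))

  accepted-inside : ∀ i → All (λ I → containedᵇ (toℚ c) (toℚ i) I ≡ true → Within (toℚ (ℤ.suc c)) (toℚ i) I) X
  accepted-inside i = All.map (λ {I} (within c⁺≤I _) accepted →
    within c⁺≤I (Within.upper (containedᵇ-true⁻¹ {toℚ c} {toℚ i} {I} accepted))) inside

  rightSize-shrinkˡ : ∀ {i} → i ℤ.< b → rightSize m a b X i ≡ rightSize m c b X i
  rightSize-shrinkˡ {i} i<b = cong (ℕ._+ rest) (begin
    outSize m a i (filterᵇ (containedᵇ (toℚ a) (toℚ i)) X) ≡⟨ cong (outSize m a i) (filterᵇ-cong X (tests-agree i)) ⟩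
    outSize m a i Y                                        ≡⟨ shrinkˡ Y (Fuel-splitˡ i<b enough) a≤c Y-inside ⟩
    outSize m c i Y                                        ∎)
    where
    open ≡-Reasoning
    Y = filterᵇ (containedᵇ (toℚ c) (toℚ i)) X
    Y-inside = filterᵇ-All (containedᵇ (toℚ c) (toℚ i)) X (accepted-inside i)
    R = scanR (toℚ i) (toℚ b) X nothing
    rest = length (maybeToList (proj₁ R)) ℕ.+ outSize m i b (proj₂ R)

  leftSize-shrinkˡ : ∀ {i} → i ℤ.< b → leftSize m a b X i ≡ leftSize m c b X i
  leftSize-shrinkˡ {i} i<b = begin
    leftSize m a b X i
      ≡⟨ cong (λ L → outSize m a i (proj₂ L) ℕ.+ (length (maybeToList (proj₁ L)) ℕ.+ rest)) (scanL-cong X (tests-agree i)) ⟩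
    outSize m a i fed ℕ.+ (length (maybeToList (proj₁ L)) ℕ.+ rest)
      ≡⟨ cong (ℕ._+ (length (maybeToList (proj₁ L)) ℕ.+ rest))
              (shrinkˡ fed (Fuel-splitˡ i<b enough) a≤c (scanL-fed X (accepted-inside i))) ⟩
    leftSize m c b X i ∎
    where
    open ≡-Reasoning
    L = scanL (toℚ c) (toℚ i) X nothing
    fed = proj₂ L
    rest = outSize m i b (filterᵇ (containedᵇ (toℚ i) (toℚ b)) X)

  rightSize-below-shrinkˡ : ∀ {i} → ℤ.suc c ℤ.< b → a ℤ.< i → i ℤ.≤ c →
                            rightSize m a b X i ℕ.≤ outSize (suc m) c b X
  rightSize-below-shrinkˡ {i} c⁺<b a<i i≤c = begin
    rightSize m a b X i
      ≡⟨ cong₂ (λ Y R → outSize m a i Y ℕ.+ (length (maybeToList (proj₁ R)) ℕ.+ outSize m i b (proj₂ R)))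
               (filterᵇ-none (containedᵇ (toℚ a) (toℚ i)) X (All.map containedᵇ-false (beyond (toℚ a) i≤c)))
               (scanR-cong X (All.zipWith (λ (i≤I , c⁺≤I) → containedᵇ-congˡ (toℚ b) i≤I c⁺≤I)
                                          (≤-inside (ℤₚ.≤-trans i≤c (ℤₚ.<⇒≤ c<c⁺)) , ≤-inside ℤₚ.≤-refl))) ⟩
    outSize m a i [] ℕ.+ (length (maybeToList (proj₁ R)) ℕ.+ outSize m i b (proj₂ R))
      ≡⟨ cong₂ (λ x y → x ℕ.+ (length (maybeToList (proj₁ R)) ℕ.+ y)) (outSize-[] m a i)
               (shrinkˡ _ (Fuel-splitʳ a<i enough) (ℤₚ.≤-trans i≤c (ℤₚ.<⇒≤ c<c⁺)) fed-inside) ⟩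
    length (maybeToList (proj₁ R)) ℕ.+ outSize m (ℤ.suc c) b (proj₂ R)
      ≤⟨ ℕₚ.m≤n+m _ (outSize m c (ℤ.suc c) (filterᵇ (containedᵇ (toℚ c) (toℚ (ℤ.suc c))) X)) ⟩
    rightSize m c b X (ℤ.suc c)
      ≤⟨ rightSize-≤ m c b X c<c⁺ c⁺<b ⟩
    outSize (suc m) c b X ∎
    where
    open ℕₚ.≤-Reasoning
    R = scanR (toℚ (ℤ.suc c)) (toℚ b) X nothing
    fed-inside : All (Within (toℚ (ℤ.suc (ℤ.suc c))) (toℚ b)) (proj₂ R)
    fed-inside = All.zipWith
      (λ (c⁺+1<I , I+1<b) → within (subst (_≤ _) (sym (toℚ-suc (ℤ.suc c))) (ℚₚ.<⇒≤ c⁺+1<I)) I+1<b)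
      (scanR-fed-≥ X (All.map (λ (within c⁺≤I _) _ → c⁺≤I) inside) ,
       scanR-fed X (All.map (λ (within _ I+1<b) _ → I+1<b) inside))

  leftSize-below-shrinkˡ : ∀ {i} → a ℤ.< i → i ℤ.≤ c → leftSize m a b X i ≡ outSize (suc m) c b X
  leftSize-below-shrinkˡ {i} a<i i≤c = begin
    leftSize m a b X i
      ≡⟨ cong₂ (λ L Y → outSize m a i (proj₂ L) ℕ.+ (length (maybeToList (proj₁ L)) ℕ.+ outSize m i b Y))
               (scanL-reject X (All.map containedᵇ-false (beyond (toℚ a) i≤c)))
               (filterᵇ-all (containedᵇ (toℚ i) (toℚ b)) X
                  (All.zipWith (λ (i≤I , within _ I+1<b) → containedᵇ-true (within i≤I I+1<b))
                               (≤-inside (ℤₚ.≤-trans i≤c (ℤₚ.<⇒≤ c<c⁺)) , inside))) ⟩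
    outSize m a i [] ℕ.+ outSize m i b X
      ≡⟨ cong₂ ℕ._+_ (outSize-[] m a i) (shrinkˡ X (Fuel-splitʳ a<i enough) i≤c inside) ⟩
    outSize m c b X
      ≡⟨ outSize-fuel m X (Fuel-narrowˡ i≤c (Fuel-splitʳ a<i enough)) ⟩
    outSize (suc m) c b X ∎
    where open ≡-Reasoning

outSize-shrinkˡ : ∀ m → ShrinkˡAt m
outSize-shrinkˡ zero    X                 _      _   _      = refl
outSize-shrinkˡ (suc m) {a} {c} {b} []    _      _   _      = trans (outSize-[] (suc m) a b) (sym (outSize-[] (suc m) c b))
outSize-shrinkˡ (suc m) {a} {c} {b} X@(_ ∷ _) enough a≤c inside@(within c⁺≤I I+1<b ∷ _) =
  ℕₚ.≤-antisym (outSize-suc-≤ m a b X bound) (outSize-suc-≤ m c b X λ i c<i i<b →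
    let a<i = ℤₚ.≤-<-trans a≤c c<i in
    ℕₚ.≤-trans (ℕₚ.≤-reflexive (sym (rightSize-shrinkˡ i<b))) (rightSize-≤ m a b X a<i i<b) ,
    ℕₚ.≤-trans (ℕₚ.≤-reflexive (sym (leftSize-shrinkˡ i<b))) (leftSize-≤ m a b X a<i i<b))
  where
  open ShrinkˡStep (outSize-shrinkˡ m) enough a≤c inside
  c⁺<b : ℤ.suc c ℤ.< b
  c⁺<b = toℚ-cancel-< (ℚₚ.≤-<-trans c⁺≤I (ℚₚ.<-trans (p<p+1 _) I+1<b))
  bound : ∀ i → a ℤ.< i → i ℤ.< b →
          rightSize m a b X i ℕ.≤ outSize (suc m) c b X × leftSize m a b X i ℕ.≤ outSize (suc m) c b X
  bound i a<i i<b with i ℤₚ.≤? c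
  ... | yes i≤c = rightSize-below-shrinkˡ c⁺<b a<i i≤c , ℕₚ.≤-reflexive (leftSize-below-shrinkˡ a<i i≤c)
  ... | no  i≰c = let c<i = ℤₚ.≰⇒> i≰c in
    ℕₚ.≤-trans (ℕₚ.≤-reflexive (rightSize-shrinkˡ i<b)) (rightSize-≤ m c b X c<i i<b) ,
    ℕₚ.≤-trans (ℕₚ.≤-reflexive (leftSize-shrinkˡ i<b)) (leftSize-≤ m c b X c<i i<b)

-- The mirror image, through the split point c-1 of A(a, c).
ShrinkʳAt : ℕ → Set
ShrinkʳAt m = ∀ {a c b} X → Fuel m a b → c ℤ.≤ b → All (Within (toℚ a) (toℚ (ℤ.pred c))) X →
              outSize m a b X ≡ outSize m a c X

module ShrinkʳStep {m : ℕ} (shrinkʳ : ShrinkʳAt m) {a c b : ℤ} {X : List Interval} (enough : Fuel (suc m) a b)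
                   (c≤b : c ℤ.≤ b) (inside : All (Within (toℚ a) (toℚ (ℤ.pred c))) X) where

  c⁻<c : ℤ.pred c ℤ.< c
  c⁻<c = ℤₚ.suc[i]≤j⇒i<j (ℤₚ.≤-reflexive (ℤₚ.suc-pred c))

  <-inside : ∀ {y} → ℤ.pred c ℤ.≤ y → All (λ I → I + 1ℚ < toℚ y) X
  <-inside c⁻≤y = All.map (λ (within _ I+1<c⁻) → ℚₚ.<-≤-trans I+1<c⁻ (toℚ-mono-≤ c⁻≤y)) inside

  beyond : ∀ y {i} → c ℤ.≤ i → All (λ I → ¬ Within (toℚ i) y I) X
  beyond y c≤i = All.map (λ (within _ I+1<c⁻) (within i≤I _) → ℚₚ.<-irrefl refl
    (ℚₚ.≤-<-trans (ℚₚ.≤-trans (toℚ-mono-≤ c≤i) i≤I)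
      (ℚₚ.<-trans (p<p+1 _) (ℚₚ.<-trans I+1<c⁻ (toℚ-mono-< c⁻<c))))) inside

  tests-agree : ∀ i → All (λ I → containedᵇ (toℚ i) (toℚ b) I ≡ containedᵇ (toℚ i) (toℚ c) I) X
  tests-agree i = All.zipWith (λ {I} (I+1<b , I+1<c) → containedᵇ-congʳ (toℚ i) I I+1<b I+1<c)
    (<-inside (ℤₚ.≤-trans (ℤₚ.<⇒≤ c⁻<c) c≤b) , <-inside (ℤₚ.<⇒≤ c⁻<c))

  accepted-inside : ∀ i → All (λ I → containedᵇ (toℚ i) (toℚ c) I ≡ true → Within (toℚ i) (toℚ (ℤ.pred c)) I) X
  accepted-inside i = All.map (λ {I} (within _ I+1<c⁻) accepted →
    within (Within.lower (containedᵇ-true⁻¹ {toℚ i} {toℚ c} {I} accepted)) I+1<c⁻) inside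

  rightSize-shrinkʳ : ∀ {i} → a ℤ.< i → rightSize m a b X i ≡ rightSize m a c X i
  rightSize-shrinkʳ {i} a<i = cong (outSize m a i (filterᵇ (containedᵇ (toℚ a) (toℚ i)) X) ℕ.+_) (begin
    length (maybeToList (proj₁ Rb)) ℕ.+ outSize m i b (proj₂ Rb)
      ≡⟨ cong (λ R → length (maybeToList (proj₁ R)) ℕ.+ outSize m i b (proj₂ R)) (scanR-cong X (tests-agree i)) ⟩
    length (maybeToList (proj₁ Rc)) ℕ.+ outSize m i b (proj₂ Rc)
      ≡⟨ cong (length (maybeToList (proj₁ Rc)) ℕ.+_) (shrinkʳ (proj₂ Rc) (Fuel-splitʳ a<i enough) c≤b
                                                              (scanR-fed X (accepted-inside i))) ⟩
    length (maybeToList (proj₁ Rc)) ℕ.+ outSize m i c (proj₂ Rc) ∎)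
    where
    open ≡-Reasoning
    Rb = scanR (toℚ i) (toℚ b) X nothing
    Rc = scanR (toℚ i) (toℚ c) X nothing

  leftSize-shrinkʳ : ∀ {i} → a ℤ.< i → leftSize m a b X i ≡ leftSize m a c X i
  leftSize-shrinkʳ {i} a<i = cong (λ n → outSize m a i (proj₂ L) ℕ.+ (length (maybeToList (proj₁ L)) ℕ.+ n)) (begin
    outSize m i b (filterᵇ (containedᵇ (toℚ i) (toℚ b)) X) ≡⟨ cong (outSize m i b) (filterᵇ-cong X (tests-agree i)) ⟩
    outSize m i b Y                                        ≡⟨ shrinkʳ Y (Fuel-splitʳ a<i enough) c≤b Y-inside ⟩
    outSize m i c Y                                        ∎)
    where
    open ≡-Reasoning
    L = scanL (toℚ a) (toℚ i) X nothing
    Y = filterᵇ (containedᵇ (toℚ i) (toℚ c)) X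
    Y-inside = filterᵇ-All (containedᵇ (toℚ i) (toℚ c)) X (accepted-inside i)

  rightSize-above-shrinkʳ : ∀ {i} → c ℤ.≤ i → i ℤ.< b → rightSize m a b X i ≡ outSize (suc m) a c X
  rightSize-above-shrinkʳ {i} c≤i i<b = begin
    rightSize m a b X i
      ≡⟨ cong₂ (λ Y R → outSize m a i Y ℕ.+ (length (maybeToList (proj₁ R)) ℕ.+ outSize m i b (proj₂ R)))
               (filterᵇ-all (containedᵇ (toℚ a) (toℚ i)) X
                  (All.zipWith (λ (within a≤I _ , I+1<i) → containedᵇ-true (within a≤I I+1<i))
                               (inside , <-inside (ℤₚ.≤-trans (ℤₚ.<⇒≤ c⁻<c) c≤i))))
               (scanR-reject X (All.map containedᵇ-false (beyond (toℚ b) c≤i))) ⟩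
    outSize m a i X ℕ.+ outSize m i b []
      ≡⟨ cong₂ ℕ._+_ (shrinkʳ X (Fuel-splitˡ i<b enough) c≤i inside) (outSize-[] m i b) ⟩
    outSize m a c X ℕ.+ 0
      ≡⟨ ℕₚ.+-identityʳ _ ⟩
    outSize m a c X
      ≡⟨ outSize-fuel m X (Fuel-narrowʳ c≤i (Fuel-splitˡ i<b enough)) ⟩
    outSize (suc m) a c X ∎
    where open ≡-Reasoning

  leftSize-above-shrinkʳ : ∀ {i} → a ℤ.< ℤ.pred c → c ℤ.≤ i → i ℤ.< b →
                           leftSize m a b X i ℕ.≤ outSize (suc m) a c X
  leftSize-above-shrinkʳ {i} a<c⁻ c≤i i<b = begin
    leftSize m a b X i
      ≡⟨ cong₂ (λ L Y → outSize m a i (proj₂ L) ℕ.+ (length (maybeToList (proj₁ L)) ℕ.+ outSize m i b Y))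
               (scanL-cong X (All.zipWith (λ {I} (I+1<i , I+1<c⁻) → containedᵇ-congʳ (toℚ a) I I+1<i I+1<c⁻)
                                          (<-inside (ℤₚ.≤-trans (ℤₚ.<⇒≤ c⁻<c) c≤i) , <-inside ℤₚ.≤-refl)))
               (filterᵇ-none (containedᵇ (toℚ i) (toℚ b)) X (All.map containedᵇ-false (beyond (toℚ b) c≤i))) ⟩
    outSize m a i (proj₂ L) ℕ.+ (length (maybeToList (proj₁ L)) ℕ.+ outSize m i b [])
      ≡⟨ cong₂ (λ x y → x ℕ.+ (length (maybeToList (proj₁ L)) ℕ.+ y))
               (shrinkʳ (proj₂ L) (Fuel-splitˡ i<b enough) (ℤₚ.≤-trans (ℤₚ.<⇒≤ c⁻<c) c≤i) fed-inside)
               (outSize-[] m i b) ⟩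
    outSize m a (ℤ.pred c) (proj₂ L) ℕ.+ (length (maybeToList (proj₁ L)) ℕ.+ 0)
      ≤⟨ ℕₚ.+-monoʳ-≤ (outSize m a (ℤ.pred c) (proj₂ L))
                      (ℕₚ.+-monoʳ-≤ (length (maybeToList (proj₁ L))) ℕ.z≤n) ⟩
    leftSize m a c X (ℤ.pred c)
      ≤⟨ leftSize-≤ m a c X a<c⁻ c⁻<c ⟩
    outSize (suc m) a c X ∎
    where
    open ℕₚ.≤-Reasoning
    L = scanL (toℚ a) (toℚ (ℤ.pred c)) X nothing
    fed-inside : All (Within (toℚ a) (toℚ (ℤ.pred (ℤ.pred c)))) (proj₂ L)
    fed-inside = All.zipWith (λ {I} (a≤I , I+2<c⁻) → within a≤I
                   (+1-cancel-< (subst (I + 1ℚ + 1ℚ <_) (toℚ-pred (ℤ.pred c)) I+2<c⁻)))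
      (scanL-fed X (All.map (λ (within a≤I _) _ → a≤I) inside) ,
       scanL-fed-≤ X (All.map (λ (within _ I+1<c⁻) _ → I+1<c⁻) inside))

outSize-shrinkʳ : ∀ m → ShrinkʳAt m
outSize-shrinkʳ zero    X                 _      _   _      = refl
outSize-shrinkʳ (suc m) {a} {c} {b} []    _      _   _      = trans (outSize-[] (suc m) a b) (sym (outSize-[] (suc m) a c))
outSize-shrinkʳ (suc m) {a} {c} {b} X@(_ ∷ _) enough c≤b inside@(within a≤I I+1<c⁻ ∷ _) =
  ℕₚ.≤-antisym (outSize-suc-≤ m a b X bound) (outSize-suc-≤ m a c X λ i a<i i<c →
    let i<b = ℤₚ.<-≤-trans i<c c≤b in
    ℕₚ.≤-trans (ℕₚ.≤-reflexive (sym (rightSize-shrinkʳ a<i))) (rightSize-≤ m a b X a<i i<b) ,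
    ℕₚ.≤-trans (ℕₚ.≤-reflexive (sym (leftSize-shrinkʳ a<i))) (leftSize-≤ m a b X a<i i<b))
  where
  open ShrinkʳStep (outSize-shrinkʳ m) enough c≤b inside
  a<c⁻ : a ℤ.< ℤ.pred c
  a<c⁻ = toℚ-cancel-< (ℚₚ.≤-<-trans a≤I (ℚₚ.<-trans (p<p+1 _) I+1<c⁻))
  bound : ∀ i → a ℤ.< i → i ℤ.< b →
          rightSize m a b X i ℕ.≤ outSize (suc m) a c X × leftSize m a b X i ℕ.≤ outSize (suc m) a c X
  bound i a<i i<b with c ℤₚ.≤? i
  ... | yes c≤i = ℕₚ.≤-reflexive (rightSize-above-shrinkʳ c≤i i<b) , leftSize-above-shrinkʳ a<c⁻ c≤i i<b
  ... | no  c≰i = let i<c = ℤₚ.≰⇒> c≰i in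
    ℕₚ.≤-trans (ℕₚ.≤-reflexive (rightSize-shrinkʳ a<i)) (rightSize-≤ m a c X a<i i<c) ,
    ℕₚ.≤-trans (ℕₚ.≤-reflexive (leftSize-shrinkʳ a<i)) (leftSize-≤ m a c X a<i i<c)

-- Uniformly random orderings

module _ {A : Set} where

  sum-map-scale : ∀ k (f : A → ℕ) xs → sum (map (λ x → k ℕ.* f x) xs) ≡ k ℕ.* sum (map f xs)
  sum-map-scale k f []       = sym (ℕₚ.*-zeroʳ k)
  sum-map-scale k f (x ∷ xs) = trans (cong (k ℕ.* f x ℕ.+_) (sum-map-scale k f xs)) (sym (ℕₚ.*-distribˡ-+ k (f x) _))

  sum-map-+ : ∀ (f g : A → ℕ) xs → sum (map (λ x → f x ℕ.+ g x) xs) ≡ sum (map f xs) ℕ.+ sum (map g xs)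
  sum-map-+ f g []       = refl
  sum-map-+ f g (x ∷ xs) = trans (cong (f x ℕ.+ g x ℕ.+_) (sum-map-+ f g xs)) (interchange (f x) (g x) _ _)
    where
    interchange : ∀ a b c d → a ℕ.+ b ℕ.+ (c ℕ.+ d) ≡ a ℕ.+ c ℕ.+ (b ℕ.+ d)
    interchange = ℕ-solve-∀

  sum-map-cong : ∀ {f g : A → ℕ} xs → All (λ x → f x ≡ g x) xs → sum (map f xs) ≡ sum (map g xs)
  sum-map-cong xs f≡g = cong sum (LP.map-cong-local f≡g)

  sum-map-const-1 : ∀ (xs : List A) → sum (map (λ _ → 1) xs) ≡ length xs
  sum-map-const-1 []       = refl
  sum-map-const-1 (x ∷ xs) = cong suc (sum-map-const-1 xs)

sum-concatMap : ∀ {A B : Set} (f : B → ℕ) (g : A → List B) xs →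
                sum (map f (concatMap g xs)) ≡ sum (map (λ x → sum (map f (g x))) xs)
sum-concatMap f g []       = refl
sum-concatMap f g (x ∷ xs) = begin
  sum (map f (g x ++ concatMap g xs))                      ≡⟨ cong sum (LP.map-++ f (g x) _) ⟩
  sum (map f (g x) ++ map f (concatMap g xs))              ≡⟨ sum-++ (map f (g x)) _ ⟩
  sum (map f (g x)) ℕ.+ sum (map f (concatMap g xs))       ≡⟨ cong (sum (map f (g x)) ℕ.+_) (sum-concatMap f g xs) ⟩
  sum (map (λ x → sum (map f (g x))) (x ∷ xs))             ∎
  where open ≡-Reasoning

All-concatMap : ∀ {A B : Set} {P : B → Set} (g : A → List B) xs → All (λ x → All P (g x)) xs → All P (concatMap g xs)
All-concatMap g xs h = Allₚ.concat⁺ (Allₚ.map⁺ h)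

insertions-All : ∀ {P : Interval → Set} {x} π → P x → All P π → All (All P) (insertions x π)
insertions-All []       px []         = (px ∷ []) ∷ []
insertions-All (y ∷ ys) px (py ∷ pys) = (px ∷ py ∷ pys) ∷ Allₚ.map⁺ (All.map (py ∷_) (insertions-All ys px pys))

orderings-All : ∀ {P : Interval → Set} xs → All P xs → All (All P) (orderings xs)
orderings-All []       []         = [] ∷ []
orderings-All (x ∷ xs) (px ∷ pxs) =
  All-concatMap (insertions x) (orderings xs) (All.map (λ {π} pπ → insertions-All π px pπ) (orderings-All xs pxs))

orderings-length : ∀ xs → All (λ π → length π ≡ length xs) (orderings xs)
orderings-length []       = refl ∷ []
orderings-length (x ∷ xs) = All-concatMap (insertions x) (orderings xs)
  (All.map (λ {π} |π|≡ → All.map (λ |σ|≡ → trans |σ|≡ (cong suc |π|≡)) (insertions-length π)) (orderings-length xs))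
  where
  insertions-length : ∀ π → All (λ σ → length σ ≡ suc (length π)) (insertions x π)
  insertions-length []       = refl ∷ []
  insertions-length (y ∷ ys) = refl ∷ Allₚ.map⁺ (All.map (cong suc) (insertions-length ys))

orderings-nonempty : ∀ xs → 0 ℕ.< length (orderings xs)
orderings-nonempty []       = ℕ.z<s
orderings-nonempty (x ∷ xs) with orderings xs | orderings-nonempty xs
... | π ∷ Π | _ = subst (0 ℕ.<_) (sym (LP.length-++ (insertions x π)))
                        (ℕₚ.<-≤-trans (head-insertion π) (ℕₚ.m≤m+n _ _))
  where
  head-insertion : ∀ π → 0 ℕ.< length (insertions x π)
  head-insertion []      = ℕ.z<s
  head-insertion (_ ∷ _) = ℕ.z<s

module _ (q : Interval → Bool) {x : Interval} (dropped : q x ≡ false) where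

  sum-insertions-filterᵇ : ∀ (F : List Interval → ℕ) π →
    sum (map (λ σ → F (filterᵇ q σ)) (insertions x π)) ≡ suc (length π) ℕ.* F (filterᵇ q π)
  sum-insertions-filterᵇ F []      = cong (λ σ → F σ ℕ.+ 0) (filterᵇ-reject q [] dropped)
  sum-insertions-filterᵇ F (y ∷ π) = cong₂ ℕ._+_ (cong F (filterᵇ-reject q (y ∷ π) dropped))
    (trans (cong sum (sym (LP.map-∘ (insertions x π)))) (later (q y) refl))
    where
    later : ∀ b → q y ≡ b →
            sum (map (λ σ → F (filterᵇ q (y ∷ σ))) (insertions x π)) ≡ suc (length π) ℕ.* F (filterᵇ q (y ∷ π))
    later true  kept = begin
      sum (map (λ σ → F (filterᵇ q (y ∷ σ))) (insertions x π))
        ≡⟨ sum-map-cong (insertions x π) (All.tabulate λ {σ} _ → cong F (filterᵇ-accept q σ kept)) ⟩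
      sum (map (λ σ → F (y ∷ filterᵇ q σ)) (insertions x π))
        ≡⟨ sum-insertions-filterᵇ (λ σ → F (y ∷ σ)) π ⟩
      suc (length π) ℕ.* F (y ∷ filterᵇ q π)
        ≡⟨ cong (λ σ → suc (length π) ℕ.* F σ) (filterᵇ-accept q π kept) ⟨
      suc (length π) ℕ.* F (filterᵇ q (y ∷ π)) ∎
      where open ≡-Reasoning
    later false lost = begin
      sum (map (λ σ → F (filterᵇ q (y ∷ σ))) (insertions x π))
        ≡⟨ sum-map-cong (insertions x π) (All.tabulate λ {σ} _ → cong F (filterᵇ-reject q σ lost)) ⟩
      sum (map (λ σ → F (filterᵇ q σ)) (insertions x π))
        ≡⟨ sum-insertions-filterᵇ F π ⟩
      suc (length π) ℕ.* F (filterᵇ q π)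
        ≡⟨ cong (λ σ → suc (length π) ℕ.* F σ) (filterᵇ-reject q π lost) ⟨
      suc (length π) ℕ.* F (filterᵇ q (y ∷ π)) ∎
      where open ≡-Reasoning

-- (n+1)(n+2)⋯(n+k): the number of orderings of k+n elements that restrict to a given ordering of n of them.
insertionFactor : ℕ → ℕ → ℕ
insertionFactor zero    n = 1
insertionFactor (suc k) n = suc (k ℕ.+ n) ℕ.* insertionFactor k n

sum-orderings-filterᵇ : ∀ (F : List Interval → ℕ) (q : Interval → Bool) Ls J → All (λ x → q x ≡ false) Ls →
  sum (map (λ π → F (filterᵇ q π)) (orderings (Ls ++ J))) ≡
  insertionFactor (length Ls) (length J) ℕ.* sum (map (λ π → F (filterᵇ q π)) (orderings J))
sum-orderings-filterᵇ F q []       J []               = sym (ℕₚ.+-identityʳ _)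
sum-orderings-filterᵇ F q (x ∷ Ls) J (dropped ∷ drops) = begin
  sum (map G (orderings (x ∷ Ls ++ J)))
    ≡⟨ sum-concatMap G (insertions x) (orderings (Ls ++ J)) ⟩
  sum (map (λ π → sum (map G (insertions x π))) (orderings (Ls ++ J)))
    ≡⟨ sum-map-cong (orderings (Ls ++ J)) (All.map (λ {π} |π|≡ → trans (sum-insertions-filterᵇ q dropped F π)
         (cong (λ k → suc k ℕ.* G π) (trans |π|≡ (LP.length-++ Ls)))) (orderings-length (Ls ++ J))) ⟩
  sum (map (λ π → k ℕ.* G π) (orderings (Ls ++ J)))
    ≡⟨ sum-map-scale k G (orderings (Ls ++ J)) ⟩
  k ℕ.* sum (map G (orderings (Ls ++ J)))
    ≡⟨ cong (k ℕ.*_) (sum-orderings-filterᵇ F q Ls J drops) ⟩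
  k ℕ.* (insertionFactor (length Ls) (length J) ℕ.* sum (map G (orderings J)))
    ≡⟨ ℕₚ.*-assoc k (insertionFactor (length Ls) (length J)) (sum (map G (orderings J))) ⟨
  insertionFactor (length (x ∷ Ls)) (length J) ℕ.* sum (map G (orderings J)) ∎
  where
  open ≡-Reasoning
  G = λ π → F (filterᵇ q π)
  k = suc (length Ls ℕ.+ length J)

sumInsertions : Interval → (List Interval → ℕ) → List Interval → ℕ
sumInsertions x F σ = sum (map F (insertions x σ))

sumInsertions-∷ : ∀ x F z σ → sumInsertions x F (z ∷ σ) ≡ F (x ∷ z ∷ σ) ℕ.+ sumInsertions x (λ w → F (z ∷ w)) σ
sumInsertions-∷ x F z σ = cong (F (x ∷ z ∷ σ) ℕ.+_) (cong sum (sym (LP.map-∘ (insertions x σ))))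

-- Inserting y and then x yields the same orderings as inserting x and then y.
sum-insertions-comm : ∀ x y (F : List Interval → ℕ) π →
  sum (map (sumInsertions x F) (insertions y π)) ≡ sum (map (sumInsertions y F) (insertions x π))
sum-insertions-comm x y F []      = swap-first (F (x ∷ y ∷ [])) (F (y ∷ x ∷ []))
  where
  swap-first : ∀ a b → a ℕ.+ (b ℕ.+ 0) ℕ.+ 0 ≡ b ℕ.+ (a ℕ.+ 0) ℕ.+ 0
  swap-first = ℕ-solve-∀
sum-insertions-comm x y F (z ∷ π) = trans lhs (trans (regroup Fxyz Fyxz A B C) (sym rhs))
  where
  Fxyz = F (x ∷ y ∷ z ∷ π)
  Fyxz = F (y ∷ x ∷ z ∷ π)
  A = sumInsertions x (λ w → F (y ∷ z ∷ w)) π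
  B = sumInsertions y (λ w → F (x ∷ z ∷ w)) π
  C = sum (map (sumInsertions y (λ w → F (z ∷ w))) (insertions x π))
  regroup : ∀ a b c d e → a ℕ.+ (b ℕ.+ c) ℕ.+ (d ℕ.+ e) ≡ b ℕ.+ (a ℕ.+ d) ℕ.+ (c ℕ.+ e)
  regroup = ℕ-solve-∀
  tail-sum : ∀ u v → sum (map (sumInsertions u F) (map (z ∷_) (insertions v π))) ≡
             sumInsertions v (λ w → F (u ∷ z ∷ w)) π ℕ.+ sum (map (sumInsertions u (λ w → F (z ∷ w))) (insertions v π))
  tail-sum u v = trans (cong sum (sym (LP.map-∘ (insertions v π))))
    (trans (sum-map-cong (insertions v π) (All.tabulate λ {σ} _ → sumInsertions-∷ u F z σ))
      (sum-map-+ (λ σ → F (u ∷ z ∷ σ)) (sumInsertions u (λ w → F (z ∷ w))) (insertions v π)))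
  lhs : sum (map (sumInsertions x F) (insertions y (z ∷ π))) ≡ Fxyz ℕ.+ (Fyxz ℕ.+ A) ℕ.+ (B ℕ.+ C)
  lhs = cong₂ ℕ._+_
          (trans (sumInsertions-∷ x F y (z ∷ π)) (cong (Fxyz ℕ.+_) (sumInsertions-∷ x (λ w → F (y ∷ w)) z π)))
                     (trans (tail-sum x y) (cong (B ℕ.+_) (sum-insertions-comm x y (λ w → F (z ∷ w)) π)))
  rhs : sum (map (sumInsertions y F) (insertions x (z ∷ π))) ≡ Fyxz ℕ.+ (Fxyz ℕ.+ B) ℕ.+ (A ℕ.+ C)
  rhs = cong₂ ℕ._+_
          (trans (sumInsertions-∷ y F x (z ∷ π)) (cong (Fyxz ℕ.+_) (sumInsertions-∷ y (λ w → F (x ∷ w)) z π)))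
                     (tail-sum y x)

sum-orderings-↭ : ∀ (F : List Interval → ℕ) {xs ys} → xs ↭ ys → sum (map F (orderings xs)) ≡ sum (map F (orderings ys))
sum-orderings-↭ F ↭-refl = refl
sum-orderings-↭ F (prep {xs} {ys} x p) = begin
  sum (map F (orderings (x ∷ xs)))                ≡⟨ sum-concatMap F (insertions x) (orderings xs) ⟩
  sum (map (sumInsertions x F) (orderings xs))    ≡⟨ sum-orderings-↭ (sumInsertions x F) p ⟩
  sum (map (sumInsertions x F) (orderings ys))    ≡⟨ sum-concatMap F (insertions x) (orderings ys) ⟨
  sum (map F (orderings (x ∷ ys)))                ∎
  where open ≡-Reasoning
sum-orderings-↭ F (swap {xs} {ys} x y p) = begin
  sum (map F (orderings (x ∷ y ∷ xs)))
    ≡⟨ sum-concatMap F (insertions x) (orderings (y ∷ xs)) ⟩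
  sum (map (sumInsertions x F) (concatMap (insertions y) (orderings xs)))
    ≡⟨ sum-concatMap (sumInsertions x F) (insertions y) (orderings xs) ⟩
  sum (map (λ π → sum (map (sumInsertions x F) (insertions y π))) (orderings xs))
    ≡⟨ sum-map-cong (orderings xs) (All.tabulate λ {π} _ → sum-insertions-comm x y F π) ⟩
  sum (map (λ π → sum (map (sumInsertions y F) (insertions x π))) (orderings xs))
    ≡⟨ sum-orderings-↭ (λ π → sum (map (sumInsertions y F) (insertions x π))) p ⟩
  sum (map (λ π → sum (map (sumInsertions y F) (insertions x π))) (orderings ys))
    ≡⟨ sum-concatMap (sumInsertions y F) (insertions x) (orderings ys) ⟨
  sum (map (sumInsertions y F) (concatMap (insertions x) (orderings ys)))
    ≡⟨ sum-concatMap F (insertions y) (orderings (x ∷ ys)) ⟨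
  sum (map F (orderings (y ∷ x ∷ ys)))
    ∎
  where open ≡-Reasoning
sum-orderings-↭ F (↭-trans p q) = trans (sum-orderings-↭ F p) (sum-orderings-↭ F q)

sum-map-suc : ∀ xs → sum (map suc xs) ≡ length xs ℕ.+ sum xs
sum-map-suc []       = refl
sum-map-suc (x ∷ xs) = cong suc (trans (cong (x ℕ.+_) (sum-map-suc xs)) (x+[n+s]≡n+[x+s] x (length xs) (sum xs)))
  where
  x+[n+s]≡n+[x+s] : ∀ x n s → x ℕ.+ (n ℕ.+ s) ≡ n ℕ.+ (x ℕ.+ s)
  x+[n+s]≡n+[x+s] = ℕ-solve-∀

length-map≡sum-map-1 : ∀ {A : Set} (f : A → ℕ) xs → length (map f xs) ≡ sum (map (λ _ → 1) xs)
length-map≡sum-map-1 f xs = trans (LP.length-map f xs) (sym (sum-map-const-1 xs))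

[n+s]/n≡1+s/n : ∀ s d → (+ (suc d ℕ.+ s)) ℚ./ suc d ≡ 1ℚ + (+ s) ℚ./ suc d
[n+s]/n≡1+s/n s d = ℚₚ.toℚᵘ-injective (ℚᵘₚ.≃-trans (ℚₚ.toℚᵘ-fromℚᵘ (ℚᵘ.mkℚᵘ (+ (suc d ℕ.+ s)) d))
  (ℚᵘₚ.≃-trans (ℚᵘ.*≡* cross) (ℚᵘₚ.≃-sym (ℚᵘₚ.≃-trans (ℚₚ.toℚᵘ-homo-+ 1ℚ ((+ s) ℚ./ suc d))
    (ℚᵘₚ.+-congʳ (toℚᵘ 1ℚ) (ℚₚ.toℚᵘ-fromℚᵘ (ℚᵘ.mkℚᵘ (+ s) d)))))))
  where
  cross : + (suc d ℕ.+ s) ℤ.* + (1 ℕ.* suc d) ≡ (1ℤ ℤ.* + suc d ℤ.+ + s ℤ.* 1ℤ) ℤ.* + suc d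
  cross = trans (cong₂ ℤ._*_ (ℤₚ.pos-+ (suc d) s) (ℤₚ.pos-* 1 (suc d))) (identity (+ suc d) (+ s))
    where
    identity : ∀ n s → (n ℤ.+ s) ℤ.* (1ℤ ℤ.* n) ≡ (1ℤ ℤ.* n ℤ.+ s ℤ.* 1ℤ) ℤ.* n
    identity = solve-∀

average-map-suc : ∀ xs → 0 ℕ.< length xs → average (map suc xs) ≡ 1ℚ + average xs
average-map-suc (x ∷ xs) _ = trans (ℚₚ./-cong (cong +_ (sum-map-suc (x ∷ xs))) (cong suc (LP.length-map suc xs)))
                                   ([n+s]/n≡1+s/n (sum (x ∷ xs)) (length xs))

average-scale : ∀ k xs ys → 0 ℕ.< length xs → sum xs ≡ k ℕ.* sum ys → length xs ≡ k ℕ.* length ys →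
                average xs ≡ average ys
average-scale k (x ∷ xs) []       _ _    len≡ = ⊥-elim (ℕₚ.1+n≢0 (trans len≡ (ℕₚ.*-zeroʳ k)))
average-scale k (x ∷ xs) (y ∷ ys) _ sum≡ len≡ =
  ℚₚ.fromℚᵘ-cong {ℚᵘ.mkℚᵘ (+ sum (x ∷ xs)) (length xs)} {ℚᵘ.mkℚᵘ (+ sum (y ∷ ys)) (length ys)}
    (ℚᵘ.*≡* (begin
      + sum (x ∷ xs) ℤ.* + length (y ∷ ys)  ≡⟨ ℤₚ.pos-* (sum (x ∷ xs)) (length (y ∷ ys)) ⟨
      + (sum (x ∷ xs) ℕ.* length (y ∷ ys))  ≡⟨ cong +_ cross ⟩
      + (sum (y ∷ ys) ℕ.* length (x ∷ xs))  ≡⟨ ℤₚ.pos-* (sum (y ∷ ys)) (length (x ∷ xs)) ⟩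
      + sum (y ∷ ys) ℤ.* + length (x ∷ xs)  ∎))
  where
  open ≡-Reasoning
  k*s*l≡s*[k*l] : ∀ k s l → k ℕ.* s ℕ.* l ≡ s ℕ.* (k ℕ.* l)
  k*s*l≡s*[k*l] = ℕ-solve-∀
  cross : sum (x ∷ xs) ℕ.* length (y ∷ ys) ≡ sum (y ∷ ys) ℕ.* length (x ∷ xs)
  cross = trans (cong (ℕ._* length (y ∷ ys)) sum≡)
         (trans (k*s*l≡s*[k*l] k (sum (y ∷ ys)) (length (y ∷ ys))) (cong (sum (y ∷ ys) ℕ.*_) (sym len≡)))

module _ (J : List Interval) where

  𝔼ord-cong : ∀ {f g} → All (λ π → f π ≡ g π) (orderings J) → 𝔼ord J f ≡ 𝔼ord J g
  𝔼ord-cong f≡g = cong average (LP.map-cong-local f≡g)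

  𝔼ord-suc : ∀ f → 𝔼ord J (λ π → suc (f π)) ≡ 1ℚ + 𝔼ord J f
  𝔼ord-suc f = trans (cong average (LP.map-∘ (orderings J)))
    (average-map-suc (map f (orderings J)) (subst (0 ℕ.<_) (sym (LP.length-map f (orderings J))) (orderings-nonempty J)))

𝔼ord-↭ : ∀ f {J K} → J ↭ K → 𝔼ord J f ≡ 𝔼ord K f
𝔼ord-↭ f {J} {K} J↭K = average-scale 1 (map f (orderings J)) (map f (orderings K))
  (subst (0 ℕ.<_) (sym (LP.length-map f (orderings J))) (orderings-nonempty J))
  (trans (sum-orderings-↭ f J↭K) (sym (ℕₚ.*-identityˡ _)))
  (trans (length-map≡sum-map-1 f (orderings J)) (trans (sum-orderings-↭ (λ _ → 1) J↭K)
    (trans (sym (length-map≡sum-map-1 f (orderings K))) (sym (ℕₚ.*-identityˡ _)))))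

𝔼ord-filterᵇ : ∀ F q Ls J → All (λ x → q x ≡ false) Ls → All (λ x → q x ≡ true) J →
               𝔼ord (Ls ++ J) (λ π → F (filterᵇ q π)) ≡ 𝔼ord J F
𝔼ord-filterᵇ F q Ls J dropped kept = average-scale (insertionFactor (length Ls) (length J))
  (map (λ π → F (filterᵇ q π)) (orderings (Ls ++ J))) (map F (orderings J))
  (subst (0 ℕ.<_) (sym (LP.length-map (λ π → F (filterᵇ q π)) (orderings (Ls ++ J)))) (orderings-nonempty (Ls ++ J)))
  (trans (sum-orderings-filterᵇ F q Ls J dropped)
    (cong (insertionFactor (length Ls) (length J) ℕ.*_) (sum-map-cong (orderings J)
      (All.map (λ {π} keptπ → cong F (filterᵇ-all q π keptπ)) (orderings-All J kept)))))
  (trans (length-map≡sum-map-1 (λ π → F (filterᵇ q π)) (orderings (Ls ++ J)))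
    (trans (sum-orderings-filterᵇ (λ _ → 1) q Ls J dropped)
    (cong (insertionFactor (length Ls) (length J) ℕ.*_) (sym (length-map≡sum-map-1 F (orderings J))))))

AtLeastOnePlusOut-witness : ∀ {Δ x e} J → ValidSet Δ J → misSize J ≡ x → e ≡ 1ℚ + expOut Δ J →
                            AtLeastOnePlusOut Δ x e
AtLeastOnePlusOut-witness {Δ} J valid mis refl ε ε>0 = J , valid , mis ,
  subst (λ y → expOut Δ J ≤ y + ε) (sym (xyx⁻¹≈y 1ℚ (expOut Δ J)))
    (subst (_≤ expOut Δ J + ε) (ℚₚ.+-identityʳ _) (ℚₚ.+-monoʳ-≤ (expOut Δ J) (ℚₚ.<⇒≤ ε>0)))

-- The run in which an optimal interval arrives first

Separated : List Interval → Set
Separated = AllPairs (λ x y → x + 1ℚ < y)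

separated-unique : ∀ {J} → Separated J → Unique J
separated-unique = AllPairs.map (λ {x} x+1<y x≡y →
  ℚₚ.<-irrefl refl (ℚₚ.<-trans (p<p+1 x) (subst (x + 1ℚ <_) (sym x≡y) x+1<y)))

separated-pairwiseIndepᵇ : ∀ {J} → Separated J → pairwiseIndepᵇ J ≡ true
separated-pairwiseIndepᵇ {[]}    []       = refl
separated-pairwiseIndepᵇ {x ∷ _} (h ∷ hs) = cong₂ _∧_ (allᵇ-true x h) (separated-pairwiseIndepᵇ hs)
  where
  allᵇ-true : ∀ x {ys} → All (λ y → x + 1ℚ < y) ys → allᵇ (independentᵇ x) ys ≡ true
  allᵇ-true x []             = refl
  allᵇ-true x (x+1<y ∷ rest) rewrite <⇒<ᵇ x+1<y = allᵇ-true x rest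

misSize-separated : ∀ J → Separated J → misSize J ≡ length J
misSize-separated J sep = ℕₚ.≤-antisym
  (maxℕ-lub _ (Allₚ.map⁺ (Allₚ.filter⁺ (T? ∘ pairwiseIndepᵇ) (sublists-length J))))
  (maxℕ-ub _ (∈-map⁺ length (∈-filter⁺ (T? ∘ pairwiseIndepᵇ) (∈-sublists J)
                                        (subst T (sym (separated-pairwiseIndepᵇ sep)) _))))
  where
  sublists-length : ∀ J → All (λ s → length s ℕ.≤ length J) (sublists J)
  sublists-length []       = ℕ.z≤n ∷ []
  sublists-length (x ∷ xs) =
    Allₚ.++⁺ (Allₚ.map⁺ (All.map ℕ.s≤s (sublists-length xs))) (All.map ℕₚ.m≤n⇒m≤1+n (sublists-length xs))
  ∈-sublists : ∀ J → J ∈ sublists J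
  ∈-sublists []       = here refl
  ∈-sublists (x ∷ xs) = ∈-++⁺ˡ (∈-map⁺ (x ∷_) (∈-sublists xs))

removeAt≡take++drop : ∀ (xs : List Interval) k → removeAt xs k ≡ take (toℕ k) xs ++ drop (suc (toℕ k)) xs
removeAt≡take++drop (x ∷ xs) zero    = refl
removeAt≡take++drop (x ∷ xs) (suc k) = cong (x ∷_) (removeAt≡take++drop xs k)

separated-before : ∀ {xs} → Separated xs → ∀ k → All (λ I → I + 1ℚ < lookup xs k) (take (toℕ k) xs)
separated-before {x ∷ xs} _        zero    = []
separated-before {x ∷ xs} (h ∷ hs) (suc k) = All.lookup h (∈-lookup k) ∷ separated-before hs k

separated-after : ∀ {xs} → Separated xs → ∀ k → All (λ I → lookup xs k + 1ℚ < I) (drop (suc (toℕ k)) xs)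
separated-after {x ∷ xs} (h ∷ hs) zero    = h
separated-after {x ∷ xs} (h ∷ hs) (suc k) = separated-after hs k

Apart : Interval → Interval → Set
Apart o I = I + 1ℚ < o ⊎ o + 1ℚ < I

module _ {Δ : ℕ} {o : Interval} (o-in-range : InRange Δ o) where

  private
    b = top-b Δ
    M = ∣ b ℤ.- top-a ∣

    Δ<b : toℚ (+ Δ) < toℚ b
    Δ<b = toℚ-mono-< (ℤ.+<+ (ℕₚ.n<1+n Δ))

    top-a≤ : ∀ {I} → 0ℚ ≤ I → toℚ top-a ≤ I
    top-a≤ 0≤I = ℚₚ.≤-trans (toℚ-mono-≤ {top-a} {+ 0} ℤ.-≤+) 0≤I

  sizeRside-first : ∀ π → All (λ I → Apart o I × InRange Δ I) π →
                    sizeRside Δ (floor o) (o ∷ π) ≡ suc (length (OUT top-a b (filterᵇ (o <ᵇ_) π)))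
  sizeRside-first π hs = begin
    sizeRside Δ l (o ∷ π)
      ≡⟨ cong (λ X → length (maybeToList (proj₁ X) ++ OUT l b (proj₂ X))) run ⟩
    suc (outSize (∣ b ℤ.- l ∣) l b Y)
      ≡⟨ cong suc (outSize-fuel-irrelevant Y (Fuel-∣b-a∣ l b) (Fuel-narrowˡ top-a≤l (Fuel-∣b-a∣ top-a b))) ⟩
    suc (outSize M l b Y)
      ≡⟨ cong suc (outSize-shrinkˡ M Y (Fuel-∣b-a∣ top-a b) top-a≤l Y-inside) ⟨
    suc (outSize M top-a b Y) ∎
    where
    open ≡-Reasoning
    l = floor o
    Y = filterᵇ (o <ᵇ_) π
    o<l+1 : o < toℚ l + 1ℚ
    o<l+1 = subst (o <_) (toℚ-suc l) (p<toℚ⌊p⌋+1 o)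
    top-a≤l : top-a ℤ.≤ l
    top-a≤l = subst (top-a ℤ.≤_) (ℤₚ.pred-suc l)
      (ℤₚ.i<j⇒i≤pred[j] (toℚ-cancel-< {top-a} {ℤ.suc l}
        (ℚₚ.≤-<-trans (top-a≤ (proj₁ o-in-range)) (p<toℚ⌊p⌋+1 o))))
    classify : ∀ {I} → Apart o I × InRange Δ I →
               (containedᵇ (toℚ l) (toℚ b) I ≡ false × ¬ o < I) ⊎
               (containedᵇ (toℚ l) (toℚ b) I ≡ true × o + 1ℚ < I)
    classify {I} (inj₁ I+1<o , _) = inj₁
      (containedᵇ-false {toℚ l} {toℚ b} {I} (λ (within l≤I _) → ℚₚ.<-irrefl refl
        (ℚₚ.≤-<-trans (ℚₚ.+-monoˡ-≤ 1ℚ l≤I) (ℚₚ.<-trans I+1<o o<l+1))) ,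
       ℚₚ.<-asym (ℚₚ.<-trans (p<p+1 I) I+1<o))
    classify (inj₂ o+1<I , (_ , I+1<Δ)) = inj₂ (containedᵇ-true (within
      (ℚₚ.≤-trans (toℚ⌊p⌋≤p o) (ℚₚ.<⇒≤ (ℚₚ.<-trans (p<p+1 o) o+1<I))) (ℚₚ.<-trans I+1<Δ Δ<b)) , o+1<I)
    run : scanR (toℚ l) (toℚ b) (o ∷ π) nothing ≡ (just o , Y)
    run = trans (scanR≡scanRWith (toℚ l) (toℚ b) (o ∷ π) nothing)
      (scanRWith-first (containedᵇ-true (within (toℚ⌊p⌋≤p o) (ℚₚ.<-trans (proj₂ o-in-range) Δ<b)))
                       π (All.map classify hs))
    Y-inside : All (Within (toℚ (ℤ.suc l)) (toℚ b)) Y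
    Y-inside = filterᵇ-All (o <ᵇ_) π (All.map kept-inside hs)
      where
      kept-inside : ∀ {I} → Apart o I × InRange Δ I → (o <ᵇ I) ≡ true → Within (toℚ (ℤ.suc l)) (toℚ b) I
      kept-inside {I} (inj₁ I+1<o , _) o<I = ⊥-elim (ℚₚ.<-asym (ℚₚ.<-trans (p<p+1 I) I+1<o) (<ᵇ⇒< o I o<I))
      kept-inside (inj₂ o+1<I , (_ , I+1<Δ)) _ = within (subst (_≤ _) (sym (toℚ-suc l))
        (ℚₚ.<⇒≤ (ℚₚ.≤-<-trans (ℚₚ.+-monoˡ-≤ 1ℚ (toℚ⌊p⌋≤p o)) o+1<I))) (ℚₚ.<-trans I+1<Δ Δ<b)

  sizeLside-first : ∀ π → All (λ I → Apart o I × InRange Δ I) π →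
                    sizeLside Δ (floor (o + toℚ (+ 2))) (o ∷ π) ≡ suc (length (OUT top-a b (filterᵇ (_<ᵇ o) π)))
  sizeLside-first π hs = begin
    sizeLside Δ r (o ∷ π)
      ≡⟨ cong (λ X → length (maybeToList (proj₁ X) ++ OUT top-a r (proj₂ X))) run ⟩
    suc (outSize (∣ r ℤ.- top-a ∣) top-a r Y)
      ≡⟨ cong suc (outSize-fuel-irrelevant Y (Fuel-∣b-a∣ top-a r) (Fuel-narrowʳ r≤b (Fuel-∣b-a∣ top-a b))) ⟩
    suc (outSize M top-a r Y)
      ≡⟨ cong suc (outSize-shrinkʳ M Y (Fuel-∣b-a∣ top-a b) r≤b Y-inside) ⟨
    suc (outSize M top-a b Y) ∎
    where
    open ≡-Reasoning
    r = floor (o + toℚ (+ 2))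
    Y = filterᵇ (_<ᵇ o) π
    o+2≡o+1+1 : o + toℚ (+ 2) ≡ o + 1ℚ + 1ℚ
    o+2≡o+1+1 = sym (ℚₚ.+-assoc o 1ℚ 1ℚ)
    o+1<r : o + 1ℚ < toℚ r
    o+1<r = +1-cancel-< (subst₂ _<_ o+2≡o+1+1 (toℚ-suc r) (p<toℚ⌊p⌋+1 (o + toℚ (+ 2))))
    r≤o+2 : toℚ r ≤ o + 1ℚ + 1ℚ
    r≤o+2 = subst (toℚ r ≤_) o+2≡o+1+1 (toℚ⌊p⌋≤p (o + toℚ (+ 2)))
    r≤b : r ℤ.≤ b
    r≤b = ℤₚ.<⇒≤ (toℚ-cancel-< {r} {b} (ℚₚ.≤-<-trans r≤o+2
      (subst (o + 1ℚ + 1ℚ <_) (sym (toℚ-suc (+ Δ))) (+1-mono-< (proj₂ o-in-range)))))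
    classify : ∀ {I} → Apart o I × InRange Δ I →
               (containedᵇ (toℚ top-a) (toℚ r) I ≡ false × ¬ I < o) ⊎
               (containedᵇ (toℚ top-a) (toℚ r) I ≡ true × I + 1ℚ < o)
    classify {I} (inj₁ I+1<o , (0≤I , _)) =
      inj₂ (containedᵇ-true (within (top-a≤ 0≤I) (ℚₚ.<-trans I+1<o (ℚₚ.<-trans (p<p+1 o) o+1<r))) , I+1<o)
    classify {I} (inj₂ o+1<I , _) = inj₁ (containedᵇ-false {toℚ top-a} {toℚ r} {I} (λ (within _ I+1<r) →
      ℚₚ.<-irrefl refl (ℚₚ.<-≤-trans (ℚₚ.<-trans (+1-mono-< o+1<I) I+1<r) r≤o+2)) ,
      ℚₚ.<-asym (ℚₚ.<-trans (p<p+1 o) o+1<I))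
    run : scanL (toℚ top-a) (toℚ r) (o ∷ π) nothing ≡ (just o , Y)
    run = trans (scanL≡scanLWith (toℚ top-a) (toℚ r) (o ∷ π) nothing)
      (scanLWith-first (containedᵇ-true (within (top-a≤ (proj₁ o-in-range)) o+1<r)) π (All.map classify hs))
    Y-inside : All (Within (toℚ top-a) (toℚ (ℤ.pred r))) Y
    Y-inside = filterᵇ-All (_<ᵇ o) π (All.map kept-inside hs)
      where
      kept-inside : ∀ {I} → Apart o I × InRange Δ I → (I <ᵇ o) ≡ true → Within (toℚ top-a) (toℚ (ℤ.pred r)) I
      kept-inside {I} (inj₁ I+1<o , (0≤I , _)) _ = within (top-a≤ 0≤I)
        (+1-cancel-< (subst (I + 1ℚ + 1ℚ <_) (toℚ-pred r) (ℚₚ.<-trans (+1-mono-< I+1<o) o+1<r)))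
      kept-inside {I} (inj₂ o+1<I , _) I<o = ⊥-elim (ℚₚ.<-asym (ℚₚ.<-trans (p<p+1 o) o+1<I) (<ᵇ⇒< I o I<o))

module _ {Δ : ℕ} {opt : List Interval} (sep : Separated opt) (in-range : All (InRange Δ) opt) (k : Fin (length opt)) where

  private
    o = lookup opt k
    before = take (toℕ k) opt
    after = drop (suc (toℕ k)) opt
    rest-apart : All (λ I → Apart o I × InRange Δ I) (removeAt opt k)
    rest-apart = subst (All _) (sym (removeAt≡take++drop opt k)) (Allₚ.++⁺
      (All.zipWith (λ (I+1<o , I-in) → inj₁ I+1<o , I-in) (separated-before sep k , Allₚ.take⁺ (toℕ k) in-range))
      (All.zipWith (λ (o+1<I , I-in) → inj₂ o+1<I , I-in) (separated-after sep k , Allₚ.drop⁺ (suc (toℕ k)) in-range)))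

  𝔼-sizeRside : 𝔼ord (removeAt opt k) (λ π → sizeRside Δ (floor o) (o ∷ π)) ≡ 1ℚ + expOut Δ after
  𝔼-sizeRside = begin
    𝔼ord (removeAt opt k) (λ π → sizeRside Δ (floor o) (o ∷ π))
      ≡⟨ 𝔼ord-cong (removeAt opt k) (All.map (sizeRside-first {Δ} (All.lookup in-range (∈-lookup k)) _)
                                             (orderings-All _ rest-apart)) ⟩
    𝔼ord (removeAt opt k) (λ π → suc (size (filterᵇ (o <ᵇ_) π)))
      ≡⟨ cong (λ J → 𝔼ord J (λ π → suc (size (filterᵇ (o <ᵇ_) π)))) (removeAt≡take++drop opt k) ⟩
    𝔼ord (before ++ after) (λ π → suc (size (filterᵇ (o <ᵇ_) π)))
      ≡⟨ 𝔼ord-filterᵇ (λ π → suc (size π)) (o <ᵇ_) before after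
           (All.map (λ {I} I+1<o → ≮⇒<ᵇ≡false (ℚₚ.<-asym (ℚₚ.<-trans (p<p+1 I) I+1<o))) (separated-before sep k))
           (All.map (λ o+1<I → <⇒<ᵇ (ℚₚ.<-trans (p<p+1 o) o+1<I)) (separated-after sep k)) ⟩
    𝔼ord after (λ π → suc (size π))
      ≡⟨ 𝔼ord-suc after size ⟩
    1ℚ + expOut Δ after ∎
    where
    open ≡-Reasoning
    size = λ π → length (OUT top-a (top-b Δ) π)

  𝔼-sizeLside : 𝔼ord (removeAt opt k) (λ π → sizeLside Δ (floor (o + toℚ (+ 2))) (o ∷ π)) ≡ 1ℚ + expOut Δ before
  𝔼-sizeLside = begin
    𝔼ord (removeAt opt k) (λ π → sizeLside Δ (floor (o + toℚ (+ 2))) (o ∷ π))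
      ≡⟨ 𝔼ord-cong (removeAt opt k) (All.map (sizeLside-first {Δ} (All.lookup in-range (∈-lookup k)) _)
                                             (orderings-All _ rest-apart)) ⟩
    𝔼ord (removeAt opt k) (λ π → suc (size (filterᵇ (_<ᵇ o) π)))
      ≡⟨ 𝔼ord-↭ (λ π → suc (size (filterᵇ (_<ᵇ o) π)))
                (↭-trans (↭-reflexive (removeAt≡take++drop opt k)) (++-comm before after)) ⟩
    𝔼ord (after ++ before) (λ π → suc (size (filterᵇ (_<ᵇ o) π)))
      ≡⟨ 𝔼ord-filterᵇ (λ π → suc (size π)) (_<ᵇ o) after before
           (All.map (λ o+1<I → ≮⇒<ᵇ≡false (ℚₚ.<-asym (ℚₚ.<-trans (p<p+1 o) o+1<I))) (separated-after sep k))
           (All.map (λ {I} I+1<o → <⇒<ᵇ (ℚₚ.<-trans (p<p+1 I) I+1<o)) (separated-before sep k)) ⟩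
    𝔼ord before (λ π → suc (size π))
      ≡⟨ 𝔼ord-suc before size ⟩
    1ℚ + expOut Δ before ∎
    where
    open ≡-Reasoning
    size = λ π → length (OUT top-a (top-b Δ) π)

lemma3 : (Δ : ℕ) → 1 ℕ.≤ Δ → (opt : List ℚ) → 3 ℕ.≤ length opt →
    AllPairs (λ x y → x + 1ℚ < y) opt → All (InRange Δ) opt →
    (k : Fin (length opt)) →
    AtLeastOnePlusOut Δ (length opt ∸ suc (toℕ k))
      (𝔼ord (removeAt opt k) (λ π → sizeRside Δ (floor (lookup opt k)) (lookup opt k ∷ π)))
    ×
    AtLeastOnePlusOut Δ (toℕ k)
      (𝔼ord (removeAt opt k) (λ π → sizeLside Δ (floor (lookup opt k + toℚ (+ 2))) (lookup opt k ∷ π)))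
lemma3 Δ _ opt _ sep in-range k =
  AtLeastOnePlusOut-witness {Δ} after (separated-unique sep-after , Allₚ.drop⁺ (suc (toℕ k)) in-range)
    (trans (misSize-separated after sep-after) (LP.length-drop (suc (toℕ k)) opt)) (𝔼-sizeRside {Δ} sep in-range k) ,
  AtLeastOnePlusOut-witness {Δ} before (separated-unique sep-before , Allₚ.take⁺ (toℕ k) in-range)
    (trans (misSize-separated before sep-before) (length-take-toℕ opt k)) (𝔼-sizeLside {Δ} sep in-range k)
  where
  before = take (toℕ k) opt
  after = drop (suc (toℕ k)) opt
  sep-before = AllPairsₚ.take⁺ (toℕ k) sep
  sep-after = AllPairsₚ.drop⁺ (suc (toℕ k)) sep
  length-take-toℕ : ∀ (xs : List ℚ) (i : Fin (length xs)) → length (take (toℕ i) xs) ≡ toℕ i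
  length-take-toℕ xs i = trans (LP.length-take (toℕ i) xs) (ℕₚ.m≤n⇒m⊓n≡m (ℕₚ.<⇒≤ (Finₚ.toℕ<n i)))
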